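{- In the setting described in the context, the sets $\mathcal A,\mathcal B,\mathcal C_1,\mathcal C_2$ are pairwise disjoint with $\mathcal D(\pi)=\mathcal A\uplus\mathcal B\uplus\mathcal C_1\uplus\mathcal C_2$, and the sets $\mathcal A',\mathcal B',\mathcal C'_1,\mathcal C'_2$ are pairwise disjoint with $\mathcal D(\hat\pi)=\mathcal A'\uplus\mathcal B'\uplus\mathcal C'_1\uplus\mathcal C'_2$.
   Context: A planar network of order $n$ is a directed, planar, acyclic multigraph embedded in the plane with $n$ sources on the left and $n$ sinks on the right, labeled $1,\dots,n$ bottom to top; edges may carry positive integer multiplicities. For an interval $[a,b]\subseteq[n]$, the simple star network $F_{[a,b]}$ has one interior vertex $x$, edges source $i\to x\to$ sink $i$ for $i\in[a,b]$ and source $i\to$ sink $i$ otherwise. A star network $F=F_{[a_1,b_1]}\cdots F_{[a_m,b_m]}$ is built from these by any combination of concatenation (identify sink $i$ of the left piece with source $i$ of the right piece, merging edges) and condensed concatenation (additionally merge $p>1$ parallel edges between two interior vertices into one edge of multiplicity $p$); its interior vertices are $x_1,\dots,x_m$. A covering path family $\pi=(\pi_1,\dots,\pi_n)\in\Pi(F)$ consists of source-to-sink paths, $\pi_i$ from source $i$, with each edge of multiplicity $p$ on exactly $p$ paths. Components of the intersection of two paths are vertices or paths $(x_k,\dots,x_\ell)$; the paths meet at the initial vertex $x_k$ of each component, which is a crossing if they enter $x_k$ and exit $x_\ell$ in different vertical orders. A defect at $x_k$ is a triple $(\pi_i,\pi_j,k)$, $i<j$, with $\pi_i,\pi_j$ meeting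 at $x_k$ after having crossed an odd number of times. For paths through $x_k$: $\pi_a\prec\pi_b$ if $\pi_a$ enters $x_k$ on an edge below that of $\pi_b$; $\pi_a\sim\pi_b$ if they enter on the same edge; $\pi_a\precsim\pi_b$ if either. Setting: fix $k\in\{2,\dots,m\}$ and $\pi\in\Pi(F)$ with a defect at $x_k$. Let $(r,t)$ be the lexicographically least pair with $(\pi_r,\pi_t,k)$ a defect; let $s$ be the largest index with $\pi_s\sim\pi_r$ at $x_k$ and $(\pi_s,\pi_t,k)$ a defect; let $x_\ell$ be the final vertex of the rightmost crossing of $\pi_s,\pi_t$ prior to $x_k$; define $\hat\pi$ by $\hat\pi_i=\pi_i$ ($i\notin\{s,t\}$), and $\hat\pi_s$ ($\hat\pi_t$) equal to $\pi_s$ ($\pi_t$) with its $x_\ell$-to-$x_k$ subpath replaced by that of $\pi_t$ ($\pi_s$). Let $\mathcal D(\pi)$ be the set of defects $(\pi_i,\pi_j,k)$ of $\pi$ at $x_k$ with $|\{i,j\}\cap\{s,t\}|=1$, and $\mathcal D(\hat\pi)$ the analogous set for $\hat\pi$. All relations below are at $x_k$. Define $\mathcal A=\{(\pi_i,\pi_j,k)\in\mathcal D(\pi):\pi_j\prec\pi_t\}$, $\mathcal B=\{(\pi_i,\pi_j,k)\in\mathcal D(\pi):\pi_s\prec\pi_i\}$, $\mathcal C_1=\{(\pi_i,\pi_j,k)\in\mathcal D(\pi):\pi_t\precsim\pi_j\prec\pi_i,\ i=s,\ j\ne t\}$, $\mathcal C_2=\{(\pi_i,\pi_j,k)\in\mathcal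 D(\pi):j=t,\ \pi_t\prec\pi_i\precsim\pi_s,\ i\ne s\}$; and $\mathcal A'=\{(\hat\pi_i,\hat\pi_j,k)\in\mathcal D(\hat\pi):\hat\pi_j\prec\hat\pi_s\}$, $\mathcal B'=\{(\hat\pi_i,\hat\pi_j,k)\in\mathcal D(\hat\pi):\hat\pi_t\prec\hat\pi_i\}$, $\mathcal C'_1=\{(\hat\pi_i,\hat\pi_j,k)\in\mathcal D(\hat\pi):\hat\pi_s\precsim\hat\pi_j\prec\hat\pi_i,\ i=t,\ j\ne s\}$, $\mathcal C'_2=\{(\hat\pi_i,\hat\pi_j,k)\in\mathcal D(\hat\pi):j=s,\ \hat\pi_s\prec\hat\pi_i\precsim\hat\pi_t,\ i\ne t\}$. -}

module Defs where

-- Star networks, covering path families, crossings and defects.  All labels are 1-based as in the paper: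
-- sources/sinks/strands 1..n, interior vertices x_1..x_m.

open import Data.Nat using (ℕ; zero; suc; _+_; _∸_; _≤_; _<_; _≡ᵇ_; _<ᵇ_; _≤ᵇ_)
open import Data.Bool using (Bool; true; false; _∧_; _∨_; not; if_then_else_; _xor_; T)
open import Data.List using (List; []; _∷_; _++_; map; length; concatMap; upTo)
open import Data.Bool.ListAction using (any)
open import Data.Maybe using (Maybe; just; nothing)
open import Data.Product using (Σ; _×_; _,_; proj₁; proj₂)
open import Data.Sum using (_⊎_)
open import Data.Unit using (⊤)
open import Data.Empty using (⊥)
open import Relation.Nullary using (¬_)
open import Relation.Binary.PropositionalEquality using (_≡_)

-- Star network expressions: leaves F_[a,b]; binary nodes are
-- concatenation (_·_) and condensed concatenation (_⊙_).

data StarNet : Set where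
  star : ℕ → ℕ → StarNet
  _·_  : StarNet → StarNet → StarNet
  _⊙_  : StarNet → StarNet → StarNet

-- number m of interior vertices
size : StarNet → ℕ
size (star _ _) = 1
size (L · R) = size L + size R
size (L ⊙ R) = size L + size R

ivls : StarNet → List (ℕ × ℕ)
ivls (star a b) = (a , b) ∷ []
ivls (L · R) = ivls L ++ ivls R
ivls (L ⊙ R) = ivls L ++ ivls R

WF : ℕ → StarNet → Set
WF n (star a b) = (1 ≤ a) × (a ≤ b) × (b ≤ n)
WF n (L · R) = WF n L × WF n R
WF n (L ⊙ R) = WF n L × WF n R

-- 1-based lookup (out of range: the empty interval [1,0])
lookupI : List (ℕ × ℕ) → ℕ → ℕ × ℕ
lookupI [] _ = (1 , 0)
lookupI (x ∷ xs) zero = (1 , 0)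
lookupI (x ∷ xs) (suc zero) = x
lookupI (x ∷ xs) (suc (suc j)) = lookupI xs (suc j)

-- strand i passes through interior vertex x_j
memb : StarNet → ℕ → ℕ → Bool
memb F j i = (proj₁ (lookupI (ivls F) j) ≤ᵇ i) ∧ (i ≤ᵇ proj₂ (lookupI (ivls F) j))

-- Parallel edges x_j → x_j' (j < j') are merged iff the concatenation
-- joining the piece containing x_j to the piece containing x_j'
-- (the least common ancestor node) is condensed.
merged : StarNet → ℕ → ℕ → Bool
merged (star _ _) j j' = false
merged (L · R) j j' =
  if j' ≤ᵇ size L then merged L j j'
  else if size L <ᵇ j then merged R (j ∸ size L) (j' ∸ size L) else false
merged (L ⊙ R) j j' =
  if j' ≤ᵇ size L then merged L j j'
  else if size L <ᵇ j then merged R (j ∸ size L) (j' ∸ size L) else true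

data V : Set where
  src : ℕ → V
  snk : ℕ → V
  int : ℕ → V

_==V_ : V → V → Bool
src a ==V src b = a ≡ᵇ b
snk a ==V snk b = a ≡ᵇ b
int a ==V int b = a ≡ᵇ b
_ ==V _ = false

from1 : ℕ → List ℕ
from1 n = map suc (upTo n)

filterᵇ : {A : Set} → (A → Bool) → List A → List A
filterᵇ p [] = []
filterᵇ p (x ∷ xs) = if p x then x ∷ filterᵇ p xs else filterᵇ p xs

firstᵇ : (ℕ → Bool) → List ℕ → ℕ   -- first element satisfying p (0 if none)
firstᵇ p [] = 0
firstᵇ p (x ∷ xs) = if p x then x else firstᵇ p xs

strandVs : StarNet → ℕ → List V
strandVs F i = src i ∷ (map int (filterᵇ (λ j → memb F j i) (from1 (size F))) ++ (snk i ∷ []))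

segs : List V → List (V × V)
segs [] = []
segs (u ∷ []) = []
segs (u ∷ v ∷ vs) = (u , v) ∷ segs (v ∷ vs)

hasSeg : StarNet → ℕ → V → V → Bool
hasSeg F i u v = any (λ p → (proj₁ p ==V u) ∧ (proj₂ p ==V v)) (segs (strandVs F i))

-- An edge is a key (tail , head , c): for an unmerged strand
-- segment c is the strand; for a merged edge c is the least strand of it.
-- Edges entering (or leaving) a vertex are vertically ordered by c.

Key : Set
Key = V × V × ℕ

ktail : Key → V
ktail (u , _ , _) = u

khead : Key → V
khead (_ , v , _) = v

klabel : Key → ℕ
klabel (_ , _ , c) = c

_==K_ : Key → Key → Bool
(u , v , c) ==K (u' , v' , c') = (u ==V u') ∧ (v ==V v') ∧ (c ≡ᵇ c')

label : StarNet → ℕ → V → V → ℕ → ℕ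
label F n (int j) (int j') i =
  if merged F j j' then firstᵇ (λ i' → hasSeg F i' (int j) (int j')) (from1 n) else i
label F n _ _ i = i

strandKeys : StarNet → ℕ → ℕ → List Key
strandKeys F n i = map (λ p → (proj₁ p , proj₂ p , label F n (proj₁ p) (proj₂ p) i)) (segs (strandVs F i))

edgeKeys : StarNet → ℕ → List Key
edgeKeys F n = concatMap (strandKeys F n) (from1 n)

IsEdge : StarNet → ℕ → Key → Set
IsEdge F n e = T (any (e ==K_) (edgeKeys F n))

-- multiplicity of an edge = number of strand segments merged into it
mult : StarNet → ℕ → Key → ℕ
mult F n e = length (filterᵇ (λ i → any (e ==K_) (strandKeys F n i)) (from1 n))

Path : Set
Path = List Key

IsSink : V → Set
IsSink (snk _) = ⊤
IsSink _ = ⊥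

ChainFrom : StarNet → ℕ → V → Path → Set
ChainFrom F n v [] = IsSink v
ChainFrom F n v (e ∷ P) = (ktail e ≡ v) × IsEdge F n e × ChainFrom F n (khead e) P

Covering : StarNet → ℕ → (ℕ → Path) → Set
Covering F n π =
  (∀ i → 1 ≤ i → i ≤ n → ChainFrom F n (src i) (π i)) ×
  (∀ e → IsEdge F n e →
     length (filterᵇ (λ i → any (e ==K_) (π i)) (from1 n)) ≡ mult F n e)

visits : Path → ℕ → Bool
visits P j = any (λ e → khead e ==V int j) P

findK : (Key → Bool) → Path → Maybe Key
findK p [] = nothing
findK p (e ∷ P) = if p e then just e else findK p P

inE : Path → ℕ → Maybe Key
inE P j = findK (λ e → khead e ==V int j) P

outE : Path → ℕ → Maybe Key
outE P j = findK (λ e → ktail e ==V int j) P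

_==MK_ : Maybe Key → Maybe Key → Bool
just a ==MK just b = a ==K b
nothing ==MK nothing = true
_ ==MK _ = false

pos : Maybe Key → ℕ
pos (just e) = klabel e
pos nothing = 0

-- x_j is the initial vertex of a component of P ∩ Q
meets : Path → Path → ℕ → Bool
meets P Q j = visits P j ∧ visits Q j ∧ not (inE P j ==MK inE Q j)

firstM : (ℕ → Bool) → List ℕ → Maybe ℕ
firstM p [] = nothing
firstM p (x ∷ xs) = if p x then just x else firstM p xs

-- final vertex x_ℓ of the component with initial vertex x_j
finalFrom : StarNet → Path → Path → ℕ → Maybe ℕ
finalFrom F P Q j =
  firstM (λ l → (j ≤ᵇ l) ∧ visits P l ∧ visits Q l ∧ not (outE P l ==MK outE Q l))
         (from1 (size F))

crossAt : StarNet → Path → Path → ℕ → Bool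
crossAt F P Q j with finalFrom F P Q j
... | just l = meets P Q j ∧
               ((pos (inE P j) <ᵇ pos (inE Q j)) xor (pos (outE P l) <ᵇ pos (outE Q l)))
... | nothing = false

oddᵇ : ℕ → Bool
oddᵇ zero = false
oddᵇ (suc n) = not (oddᵇ n)

crossCount : StarNet → Path → Path → ℕ → ℕ
crossCount F P Q k = length (filterᵇ (crossAt F P Q) (from1 (k ∸ 1)))

Defect : StarNet → ℕ → (ℕ → Path) → ℕ → ℕ → ℕ → Set
Defect F n π i j k =
  (1 ≤ i) × (i < j) × (j ≤ n) ×
  T (meets (π i) (π j) k) × T (oddᵇ (crossCount F (π i) (π j) k))

Prec : Path → Path → ℕ → Set
Prec P Q k = T (visits P k ∧ visits Q k) × (pos (inE P k) < pos (inE Q k))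

Sim : Path → Path → ℕ → Set
Sim P Q k = T (visits P k ∧ visits Q k) × (inE P k ≡ inE Q k)

PrecSim : Path → Path → ℕ → Set
PrecSim P Q k = Prec P Q k ⊎ Sim P Q k

LeastDefect : StarNet → ℕ → (ℕ → Path) → ℕ → ℕ → ℕ → Set
LeastDefect F n π k r t =
  Defect F n π r t k ×
  (∀ i j → Defect F n π i j k → (r < i) ⊎ ((r ≡ i) × (t ≤ j)))

LargestS : StarNet → ℕ → (ℕ → Path) → ℕ → ℕ → ℕ → ℕ → Set
LargestS F n π k r t s =
  Sim (π s) (π r) k × Defect F n π s t k ×
  (∀ s' → Sim (π s') (π r) k → Defect F n π s' t k → s' ≤ s)

RightmostCrossing : StarNet → (ℕ → Path) → ℕ → ℕ → ℕ → ℕ → ℕ → Set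
RightmostCrossing F π k s t j0 l =
  (1 ≤ j0) × (j0 < k) × T (crossAt F (π s) (π t) j0) ×
  (∀ j → j0 < j → j < k → crossAt F (π s) (π t) j ≡ false) ×
  (finalFrom F (π s) (π t) j0 ≡ just l)

upToV : V → Path → Path
upToV v [] = []
upToV v (e ∷ P) = if khead e ==V v then e ∷ [] else e ∷ upToV v P

afterV : V → Path → Path
afterV v [] = []
afterV v (e ∷ P) = if khead e ==V v then P else afterV v P

-- P with its x_ℓ-to-x_k subpath replaced by that of Q
swapSeg : ℕ → ℕ → Path → Path → Path
swapSeg l k P Q = upToV (int l) P ++ (upToV (int k) (afterV (int l) Q) ++ afterV (int k) P)

hat : (ℕ → Path) → ℕ → ℕ → ℕ → ℕ → (ℕ → Path)
hat π s t l k i =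
  if i ≡ᵇ s then swapSeg l k (π s) (π t)
  else if i ≡ᵇ t then swapSeg l k (π t) (π s) else π i

DSet : StarNet → ℕ → (ℕ → Path) → ℕ → ℕ → ℕ → ℕ → ℕ → Set
DSet F n ρ k s t i j =
  Defect F n ρ i j k × T (((i ≡ᵇ s) ∨ (i ≡ᵇ t)) xor ((j ≡ᵇ s) ∨ (j ≡ᵇ t)))

DisjointUnion4 : (D A B C1 C2 : ℕ → ℕ → Set) → Set
DisjointUnion4 D A B C1 C2 = ∀ i j →
  (D i j → A i j ⊎ B i j ⊎ C1 i j ⊎ C2 i j) ×
  (A i j ⊎ B i j ⊎ C1 i j ⊎ C2 i j → D i j) ×
  ¬ (A i j × B i j) × ¬ (A i j × C1 i j) × ¬ (A i j × C2 i j) ×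
  ¬ (B i j × C1 i j) × ¬ (B i j × C2 i j) × ¬ (C1 i j × C2 i j)

SetA SetB SetC1 SetC2 : StarNet → ℕ → (ℕ → Path) → ℕ → ℕ → ℕ → ℕ → ℕ → Set
SetA F n π k s t i j = DSet F n π k s t i j × Prec (π j) (π t) k
SetB F n π k s t i j = DSet F n π k s t i j × Prec (π s) (π i) k
SetC1 F n π k s t i j =
  DSet F n π k s t i j × PrecSim (π t) (π j) k × Prec (π j) (π i) k × (i ≡ s) × ¬ (j ≡ t)
SetC2 F n π k s t i j =
  DSet F n π k s t i j × (j ≡ t) × Prec (π t) (π i) k × PrecSim (π i) (π s) k × ¬ (i ≡ s)

SetA' SetB' SetC1' SetC2' : StarNet → ℕ → (ℕ → Path) → ℕ → ℕ → ℕ → ℕ → ℕ → Set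
SetA' F n ρ k s t i j = DSet F n ρ k s t i j × Prec (ρ j) (ρ s) k
SetB' F n ρ k s t i j = DSet F n ρ k s t i j × Prec (ρ t) (ρ i) k
SetC1' F n ρ k s t i j =
  DSet F n ρ k s t i j × PrecSim (ρ s) (ρ j) k × Prec (ρ j) (ρ i) k × (i ≡ t) × ¬ (j ≡ s)
SetC2' F n ρ k s t i j =
  DSet F n ρ k s t i j × (j ≡ s) × Prec (ρ s) (ρ i) k × PrecSim (ρ i) (ρ t) k × ¬ (i ≡ t)

{-# OPTIONS --safe #-}
-- Scan the gaps between consecutive interior vertices from left to right. Two paths of a covering
-- family either run over a gap on distinct edges, whose labels (the vertical order of edges) are
-- ordered as the parity of the crossings so far dictates, or on one common edge inside a shared
-- component; a component changes the parity exactly when it reverses the order. Hence at a defect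
-- (π_i, π_j, k) the path π_j enters x_k below π_i. An edge is determined by its label and any gap
-- it runs over, so ≺ and ∼ at x_k compare entry labels and are trichotomous. Since π_t ≺ π_s, each
-- defect with exactly one index in {s, t} falls into exactly one of 𝒜, ℬ, 𝒞₁, 𝒞₂ by comparing its
-- other path with π_t or π_s. The crossing with final vertex x_ℓ ends before π_s and π_t meet
-- again at x_k, so π̂ is again a family of paths, in which π̂_s and π̂_t enter x_k on the edges of
-- π_t and π_s; the same argument with s and t exchanged gives the decomposition for π̂.

module Submission where

open import Defs
open import Data.Nat using (ℕ; zero; suc; _+_; _≤_; _<_; _≡ᵇ_; _<ᵇ_; _≤ᵇ_; _≟_; z≤n; s≤s)
open import Data.Nat.Properties
  using (≡ᵇ⇒≡; ≡⇒≡ᵇ; <ᵇ⇒<; <⇒<ᵇ; ≤ᵇ⇒≤; ≤⇒≤ᵇ; ≤-refl; ≤-trans; <-trans; <-irrefl;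
         ≤-reflexive; <-≤-trans; ≤-<-trans; ≤-pred; +-suc; +-identityʳ; +-comm; n≤1+n; n<1+n;
         <⇒≤; ≮⇒≥; ≰⇒>; <-cmp; <-asym; m≤n⇒m<n∨m≡n; ≤-antisym; ≤-<-connex; <-≤-connex; m≤m+n)
open import Data.Bool using (Bool; true; false; _∧_; _∨_; not; if_then_else_; _xor_; T)
open import Data.Bool.Properties
  using (T-≡; T-∧; T-∨; if-cong; xor-comm; xor-assoc; true-xor; xor-identityʳ; ∧-zeroʳ)
open import Data.Bool.ListAction using (any)
open import Data.List using (List; []; _∷_; _++_; [_]; map; length; upTo; applyUpTo)
open import Data.List.Properties using (length-++; map-++; map-upTo; upTo-∷ʳ)
open import Data.List.Membership.Propositional using (_∈_; find; lose)
open import Data.List.Relation.Unary.All as All using (All; []; _∷_)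
open import Data.List.Relation.Unary.Any using (here; there)
open import Data.List.Relation.Unary.Any.Properties using (any⁺; any⁻; concatMap⁻; map⁻)
open import Data.Maybe using (Maybe; just; nothing)
open import Data.Product using (∃; _×_; _,_; proj₁; proj₂; uncurry)
open import Data.Sum using (_⊎_; inj₁; inj₂; swap)
open import Data.Unit using (tt)
open import Data.Empty using (⊥; ⊥-elim)
open import Function using (_∘_; Equivalence)
open import Relation.Nullary using (¬_; Dec; yes; no)
open import Relation.Binary.Definitions using (tri<; tri≈; tri>)
open import Relation.Binary.PropositionalEquality
  using (_≡_; _≢_; refl; sym; trans; cong; cong₂; subst; subst₂; module ≡-Reasoning)

T⇒≡true : ∀ {b} → T b → b ≡ true
T⇒≡true = Equivalence.to T-≡

≡true⇒T : ∀ {b} → b ≡ true → T b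
≡true⇒T = Equivalence.from T-≡

≡false⇒¬T : ∀ {b} → b ≡ false → ¬ T b
≡false⇒¬T refl ()

¬T⇒≡false : ∀ {b} → ¬ T b → b ≡ false
¬T⇒≡false {true} ¬t = ⊥-elim (¬t tt)
¬T⇒≡false {false} _ = refl

T-∧⁻ : ∀ {a b} → T (a ∧ b) → T a × T b
T-∧⁻ = Equivalence.to T-∧

T-∧⁺ : ∀ {a b} → T a → T b → T (a ∧ b)
T-∧⁺ ta tb = Equivalence.from T-∧ (ta , tb)

T-∨⁻ : ∀ {a b} → T (a ∨ b) → T a ⊎ T b
T-∨⁻ = Equivalence.to T-∨

==V⇒≡ : ∀ u v → T (u ==V v) → u ≡ v
==V⇒≡ (src a) (src b) h = cong src (≡ᵇ⇒≡ a b h)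
==V⇒≡ (snk a) (snk b) h = cong snk (≡ᵇ⇒≡ a b h)
==V⇒≡ (int a) (int b) h = cong int (≡ᵇ⇒≡ a b h)

==V-refl : ∀ u → T (u ==V u)
==V-refl (src a) = ≡⇒≡ᵇ a a refl
==V-refl (snk a) = ≡⇒≡ᵇ a a refl
==V-refl (int a) = ≡⇒≡ᵇ a a refl

==K⇒≡ : ∀ a b → T (a ==K b) → a ≡ b
==K⇒≡ (u , v , c) (u' , v' , c') h
  with T-∧⁻ {u ==V u'} h
... | hu , hvc with T-∧⁻ {v ==V v'} hvc
... | hv , hc with ==V⇒≡ u u' hu | ==V⇒≡ v v' hv | ≡ᵇ⇒≡ c c' hc
... | refl | refl | refl = refl

==K-refl : ∀ a → T (a ==K a)
==K-refl (u , v , c) = T-∧⁺ {u ==V u} (==V-refl u) (T-∧⁺ {v ==V v} (==V-refl v) (≡⇒≡ᵇ c c refl))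

≢⇒==K-false : ∀ a b → a ≢ b → (a ==K b) ≡ false
≢⇒==K-false a b a≢b = ¬T⇒≡false (a≢b ∘ ==K⇒≡ a b)

_≟K_ : (a b : Key) → Dec (a ≡ b)
a ≟K b with a ==K b in same
... | true = yes (==K⇒≡ a b (≡true⇒T same))
... | false = no λ { refl → ≡false⇒¬T same (==K-refl a) }

==MK⇒≡ : ∀ a b → T (a ==MK b) → a ≡ b
==MK⇒≡ (just a) (just b) h = cong just (==K⇒≡ a b h)
==MK⇒≡ nothing nothing h = refl

==MK-refl : ∀ a → (a ==MK a) ≡ true
==MK-refl (just a) = T⇒≡true (==K-refl a)
==MK-refl nothing = refl

any-∈ : ∀ {A : Set} (p : A → Bool) {x : A} {xs : List A} → x ∈ xs → T (p x) → T (any p xs)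
any-∈ p x∈xs px = any⁺ p (lose x∈xs px)

firstᵇ-sound : (p : ℕ → Bool) (xs : List ℕ) → T (any p xs) → T (p (firstᵇ p xs))
firstᵇ-sound p (x ∷ xs) h with p x in px
... | true = ≡true⇒T px
... | false = firstᵇ-sound p xs h

findK-sound : ∀ (p : Key → Bool) xs {e} → findK p xs ≡ just e → T (p e) × e ∈ xs
findK-sound p (x ∷ xs) eq with p x in px
findK-sound p (x ∷ xs) refl | true = ≡true⇒T px , here refl
... | false = let pe , e∈xs = findK-sound p xs eq in pe , there e∈xs

findK-complete : ∀ (p : Key → Bool) xs → T (any p xs) → ∃ λ e → findK p xs ≡ just e
findK-complete p (x ∷ xs) h with p x
... | true = x , refl
... | false = findK-complete p xs h

findK-weaken : ∀ (p q : Key → Bool) xs {e} → (∀ x → T (q x) → T (p x)) →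
  findK p xs ≡ just e → T (q e) → findK q xs ≡ just e
findK-weaken p q (x ∷ xs) q⇒p eq qe with p x in px
findK-weaken p q (x ∷ xs) q⇒p refl qe | true with q x
... | true = refl
... | false = ⊥-elim qe
findK-weaken p q (x ∷ xs) q⇒p eq qe | false with q x in qx
... | true = ⊥-elim (≡false⇒¬T px (q⇒p x (≡true⇒T qx)))
... | false = findK-weaken p q xs q⇒p eq qe

findK-++ˡ : ∀ (p : Key → Bool) xs ys {e} → findK p xs ≡ just e → findK p (xs ++ ys) ≡ just e
findK-++ˡ p (x ∷ xs) ys eq with p x
... | true = eq
... | false = findK-++ˡ p xs ys eq

findK-++ʳ : ∀ (p : Key → Bool) xs ys → (∀ {x} → x ∈ xs → ¬ T (p x)) → findK p (xs ++ ys) ≡ findK p ys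
findK-++ʳ p [] ys _ = refl
findK-++ʳ p (x ∷ xs) ys ¬p with p x in px
... | true = ⊥-elim (¬p (here refl) (≡true⇒T px))
... | false = findK-++ʳ p xs ys (¬p ∘ there)

filterᵇ-++ : ∀ {A : Set} (p : A → Bool) xs ys → filterᵇ p (xs ++ ys) ≡ filterᵇ p xs ++ filterᵇ p ys
filterᵇ-++ p [] ys = refl
filterᵇ-++ p (x ∷ xs) ys with p x
... | true = cong (x ∷_) (filterᵇ-++ p xs ys)
... | false = filterᵇ-++ p xs ys

length-filterᵇ-singleton : ∀ {A : Set} (p : A → Bool) x → length (filterᵇ p [ x ]) ≡ (if p x then 1 else 0)
length-filterᵇ-singleton p x with p x
... | true = refl
... | false = refl

range : ℕ → ℕ → List ℕ
range a zero = []
range a (suc c) = a ∷ range (suc a) c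

applyUpTo-range : ∀ (f : ℕ → ℕ) a c → (∀ x → f x ≡ a + x) → applyUpTo f c ≡ range a c
applyUpTo-range f a zero _ = refl
applyUpTo-range f a (suc c) f≗a+ =
  cong₂ _∷_ (trans (f≗a+ 0) (+-identityʳ a))
            (applyUpTo-range (f ∘ suc) (suc a) c (λ x → trans (f≗a+ (suc x)) (+-suc a x)))

from1-range : ∀ m → from1 m ≡ range 1 m
from1-range m = trans (map-upTo suc m) (applyUpTo-range suc 1 m (λ _ → refl))

from1-∷ʳ : ∀ c → from1 (suc c) ≡ from1 c ++ [ suc c ]
from1-∷ʳ c = trans (cong (map suc) (sym (upTo-∷ʳ c))) (map-++ suc (upTo c) [ c ])

firstM-range-complete : ∀ (p : ℕ → Bool) c a l → a ≤ l → l < a + c → T (p l) →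
  (∀ l' → a ≤ l' → l' < l → p l' ≡ false) → firstM p (range a c) ≡ just l
firstM-range-complete p zero a l a≤l l<a+0 _ _ =
  ⊥-elim (<-irrefl refl (≤-trans l<a+0 (≤-trans (≤-reflexive (+-identityʳ a)) a≤l)))
firstM-range-complete p (suc c) a l a≤l l<a+c pl before with m≤n⇒m<n∨m≡n a≤l | p a in pa
... | inj₂ refl | true = refl
... | inj₂ refl | false = ⊥-elim (≡false⇒¬T pa pl)
... | inj₁ a<l | true = ⊥-elim (≡false⇒¬T (before a ≤-refl a<l) (≡true⇒T pa))
... | inj₁ a<l | false =
  firstM-range-complete p c (suc a) l a<l (subst (l <_) (+-suc a c) l<a+c) pl (λ l' a<l' → before l' (<⇒≤ a<l'))

firstM-range-sound : ∀ (p : ℕ → Bool) c a l → firstM p (range a c) ≡ just l →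
  a ≤ l × T (p l) × (∀ l' → a ≤ l' → l' < l → p l' ≡ false)
firstM-range-sound p (suc c) a l eq with p a in pa
firstM-range-sound p (suc c) a l refl | true =
  ≤-refl , ≡true⇒T pa , λ l' a≤l' l'<a → ⊥-elim (<-irrefl refl (≤-<-trans a≤l' l'<a))
... | false with firstM-range-sound p c (suc a) l eq
... | a<l , pl , before = <⇒≤ a<l , pl , before'
  where
  before' : ∀ l' → a ≤ l' → l' < l → p l' ≡ false
  before' l' a≤l' l'<l with m≤n⇒m<n∨m≡n a≤l'
  ... | inj₁ a<l' = before l' a<l' l'<l
  ... | inj₂ refl = pa

rank : ℕ → V → ℕ
rank m (src _) = 0
rank m (int w) = w
rank m (snk _) = suc m

OnStrand : StarNet → ℕ → ℕ → Set
OnStrand F c w = T (memb F w c) × 1 ≤ w × w ≤ size F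

TailOf : StarNet → ℕ → V → Set
TailOf F c (src c') = c' ≡ c
TailOf F c (int w) = OnStrand F c w
TailOf F c (snk _) = ⊥

HeadOf : StarNet → ℕ → V → Set
HeadOf F c (src _) = ⊥
HeadOf F c (int w) = OnStrand F c w
HeadOf F c (snk c') = c' ≡ c

record Segment (F : StarNet) (c : ℕ) (u v : V) : Set where
  field
    rising : rank (size F) u < rank (size F) v
    skips : ∀ w → rank (size F) u < w → w < rank (size F) v → w ≤ size F → memb F w c ≡ false
    tail-on : TailOf F c u
    head-on : HeadOf F c v

open Segment

strand-segments : ∀ F c cnt a v₀ → a + cnt ≡ suc (size F) → rank (size F) v₀ < a → TailOf F c v₀ →
  (∀ w → rank (size F) v₀ < w → w < a → memb F w c ≡ false) →
  All (uncurry (Segment F c)) (segs (v₀ ∷ map int (filterᵇ (λ j → memb F j c) (range a cnt)) ++ [ snk c ]))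
strand-segments F c zero a v₀ a+0≡ v₀<a t₀ skip = last ∷ []
  where
  a≡ : a ≡ suc (size F)
  a≡ = trans (sym (+-identityʳ a)) a+0≡
  last : Segment F c v₀ (snk c)
  last = record { rising = subst (_ <_) a≡ v₀<a ; skips = λ w lo hi _ → skip w lo (subst (w <_) (sym a≡) hi)
                ; tail-on = t₀ ; head-on = refl }
strand-segments F c (suc cnt) a v₀ a+cnt≡ v₀<a t₀ skip with memb F a c in ma
... | true = step ∷ strand-segments F c cnt (suc a) (int a) (trans (sym (+-suc a cnt)) a+cnt≡) ≤-refl on-a
                      (λ w a<w w<1+a → ⊥-elim (<-irrefl refl (<-≤-trans a<w (≤-pred w<1+a))))
  where
  on-a : OnStrand F c a
  on-a = ≡true⇒T ma , ≤-trans (s≤s z≤n) v₀<a ,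
         ≤-pred (≤-trans (s≤s (m≤m+n a cnt)) (≤-reflexive (trans (sym (+-suc a cnt)) a+cnt≡)))
  step : Segment F c v₀ (int a)
  step = record { rising = v₀<a ; skips = λ w lo hi _ → skip w lo hi ; tail-on = t₀ ; head-on = on-a }
... | false =
  strand-segments F c cnt (suc a) v₀ (trans (sym (+-suc a cnt)) a+cnt≡) (≤-trans v₀<a (n≤1+n a)) t₀ skip'
  where
  skip' : ∀ w → rank (size F) v₀ < w → w < suc a → memb F w c ≡ false
  skip' w lo hi with m≤n⇒m<n∨m≡n (≤-pred hi)
  ... | inj₁ w<a = skip w lo w<a
  ... | inj₂ refl = ma

hasSeg⇒Segment : ∀ F c u v → T (hasSeg F c u v) → Segment F c u v
hasSeg⇒Segment F c u v h with find (any⁻ _ (segs (strandVs F c)) h)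
... | (u' , v') , uv∈ , match
  with ==V⇒≡ u' u (proj₁ (T-∧⁻ match)) | ==V⇒≡ v' v (proj₂ (T-∧⁻ {u' ==V u} match))
... | refl | refl = All.lookup segments uv∈
  where
  segments : All (uncurry (Segment F c)) (segs (strandVs F c))
  segments = subst (λ L → All (uncurry (Segment F c))
                                (segs (src c ∷ map int (filterᵇ (λ j → memb F j c) L) ++ [ snk c ])))
                   (sym (from1-range (size F)))
                   (strand-segments F c (size F) 1 (src c) refl (s≤s z≤n) refl
                      (λ { w (s≤s _) (s≤s ()) }))

label-hasSeg : ∀ F n u v i → T (hasSeg F i u v) → i ∈ from1 n → T (hasSeg F (label F n u v i) u v)
label-hasSeg F n (src _) v i h _ = h
label-hasSeg F n (snk _) v i h _ = h
label-hasSeg F n (int j) (src _) i h _ = h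
label-hasSeg F n (int j) (snk _) i h _ = h
label-hasSeg F n (int j) (int j') i h i∈ with merged F j j'
... | true = firstᵇ-sound has (from1 n) (any-∈ has i∈ h)
  where
  has = λ i' → hasSeg F i' (int j) (int j')
... | false = h

edge-segment : ∀ F n e → IsEdge F n e → Segment F (klabel e) (ktail e) (khead e)
edge-segment F n e ise with find (concatMap⁻ (strandKeys F n) {xs = from1 n} (any⁻ _ _ ise))
... | i , i∈ , onStrand with find (map⁻ {xs = segs (strandVs F i)} onStrand)
... | (u , v) , uv∈ , match with ==K⇒≡ e (u , v , label F n u v i) match
... | refl = hasSeg⇒Segment F _ u v (label-hasSeg F n u v i hasSeg-i i∈)
  where
  hasSeg-i : T (hasSeg F i u v)
  hasSeg-i = any-∈ _ uv∈ (T-∧⁺ {u ==V u} (==V-refl u) (==V-refl v))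

Spans : ℕ → Key → ℕ → Set
Spans m e τ = rank m (ktail e) ≤ τ × τ < rank m (khead e)

module _ {F : StarNet} {c : ℕ} where

  private
    r : V → ℕ
    r = rank (size F)

  tail-not-skipped : ∀ {u v u' v'} → Segment F c u v → Segment F c u' v' → r u < r u' → r u' < r v → ⊥
  tail-not-skipped {u' = int w} σ σ' u<w w<v =
    ≡false⇒¬T (skips σ w u<w w<v (proj₂ (proj₂ (tail-on σ')))) (proj₁ (tail-on σ'))
  tail-not-skipped {u' = snk _} σ σ' _ _ = tail-on σ'

  head-not-skipped : ∀ {u v u' v'} → Segment F c u v → Segment F c u' v' → r u' < r v → r v < r v' → ⊥
  head-not-skipped {v = src _} σ σ' _ _ = head-on σ
  head-not-skipped {v = int w} σ σ' u'<w w<v' =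
    ≡false⇒¬T (skips σ' w u'<w w<v' (proj₂ (proj₂ (head-on σ)))) (proj₁ (head-on σ))
  head-not-skipped {v = snk _} {v' = src _} σ σ' _ _ = head-on σ'
  head-not-skipped {v = snk _} {v' = int w'} σ σ' _ m<w' =
    <-irrefl refl (<-≤-trans m<w' (≤-trans (proj₂ (proj₂ (head-on σ'))) (n≤1+n _)))
  head-not-skipped {v = snk _} {v' = snk _} σ σ' _ m<m = <-irrefl refl m<m

  tail-unique : ∀ x y → TailOf F c x → TailOf F c y → r x ≡ r y → x ≡ y
  tail-unique (src a) (src b) refl refl _ = refl
  tail-unique (int a) (int b) _ _ refl = refl
  tail-unique (src a) (int b) _ (_ , 1≤b , _) 0≡b = ⊥-elim (<-irrefl 0≡b 1≤b)
  tail-unique (int a) (src b) (_ , 1≤a , _) _ a≡0 = ⊥-elim (<-irrefl (sym a≡0) 1≤a)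

  head-unique : ∀ x y → HeadOf F c x → HeadOf F c y → r x ≡ r y → x ≡ y
  head-unique (snk a) (snk b) refl refl _ = refl
  head-unique (int a) (int b) _ _ refl = refl
  head-unique (int a) (snk b) (_ , _ , a≤m) _ a≡ = ⊥-elim (<-irrefl a≡ (s≤s a≤m))
  head-unique (snk a) (int b) _ (_ , _ , b≤m) ≡b = ⊥-elim (<-irrefl (sym ≡b) (s≤s b≤m))

  overlapping-segments : ∀ {u v u' v' τ} → Segment F c u v → Segment F c u' v' →
    r u ≤ τ → τ < r v → r u' ≤ τ → τ < r v' → u ≡ u' × v ≡ v'
  overlapping-segments {u} {v} {u'} {v'} σ σ' u≤τ τ<v u'≤τ τ<v' = same-tail , same-head
    where
    same-tail : u ≡ u'
    same-tail with <-cmp (r u) (r u')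
    ... | tri< u<u' _ _ = ⊥-elim (tail-not-skipped σ σ' u<u' (≤-<-trans u'≤τ τ<v))
    ... | tri≈ _ u≡u' _ = tail-unique u u' (tail-on σ) (tail-on σ') u≡u'
    ... | tri> _ _ u'<u = ⊥-elim (tail-not-skipped σ' σ u'<u (≤-<-trans u≤τ τ<v'))
    same-head : v ≡ v'
    same-head with <-cmp (r v) (r v')
    ... | tri< v<v' _ _ = ⊥-elim (head-not-skipped σ σ' (≤-<-trans u'≤τ τ<v) v<v')
    ... | tri≈ _ v≡v' _ = head-unique v v' (head-on σ) (head-on σ') v≡v'
    ... | tri> _ _ v'<v = ⊥-elim (head-not-skipped σ' σ (≤-<-trans u≤τ τ<v') v'<v)

edge-unique : ∀ F n {e e'} τ → IsEdge F n e → IsEdge F n e' → klabel e ≡ klabel e' →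
  Spans (size F) e τ → Spans (size F) e' τ → e ≡ e'
edge-unique F n {u , v , c} {u' , v' , .c} τ ise ise' refl (u≤τ , τ<v) (u'≤τ , τ<v')
  with overlapping-segments (edge-segment F n (u , v , c) ise) (edge-segment F n (u' , v' , c) ise')
                            u≤τ τ<v u'≤τ τ<v'
... | refl , refl = refl

memb-convex : ∀ F w {c₁ c₂ d} → T (memb F w c₁) → T (memb F w c₂) → memb F w d ≡ false →
  (c₁ < d → c₂ < d) × (d < c₁ → d < c₂)
memb-convex F w {c₁} {c₂} {d} m₁ m₂ ¬md = above , below
  where
  a = proj₁ (lookupI (ivls F) w)
  b = proj₂ (lookupI (ivls F) w)
  bounds : ∀ {x} → T (memb F w x) → a ≤ x × x ≤ b
  bounds mx = let (a≤x , x≤b) = T-∧⁻ mx in ≤ᵇ⇒≤ _ _ a≤x , ≤ᵇ⇒≤ _ _ x≤b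
  d∉ : a ≤ d → d ≤ b → ⊥
  d∉ a≤d d≤b = ≡false⇒¬T ¬md (T-∧⁺ (≤⇒≤ᵇ a≤d) (≤⇒≤ᵇ d≤b))
  above : c₁ < d → c₂ < d
  above c₁<d with ≤-<-connex d b
  ... | inj₁ d≤b = ⊥-elim (d∉ (≤-trans (proj₁ (bounds m₁)) (<⇒≤ c₁<d)) d≤b)
  ... | inj₂ b<d = ≤-<-trans (proj₂ (bounds m₂)) b<d
  below : d < c₁ → d < c₂
  below d<c₁ with <-≤-connex d a
  ... | inj₁ d<a = <-≤-trans d<a (proj₁ (bounds m₂))
  ... | inj₂ a≤d = ⊥-elim (d∉ a≤d (≤-trans (<⇒≤ d<c₁) (proj₂ (bounds m₁))))

inE≡just⇒visits : ∀ R k {e} → inE R k ≡ just e → T (visits R k)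
inE≡just⇒visits R k eq =
  let (hd , e∈R) = findK-sound (λ e → khead e ==V int k) R eq in any-∈ (λ e → khead e ==V int k) e∈R hd

module Chains (F : StarNet) (n : ℕ) where

  m : ℕ
  m = size F

  -- Along a chain that starts at rank ≤ τ this is the edge running from x_{≤τ} to x_{>τ}.
  spanning : Path → ℕ → Maybe Key
  spanning P τ = findK (λ e → τ <ᵇ rank m (khead e)) P

  chain-edge : ∀ {v P e} → ChainFrom F n v P → e ∈ P → IsEdge F n e
  chain-edge {P = _ ∷ _} (_ , ise , _) (here refl) = ise
  chain-edge {P = _ ∷ _} (_ , _ , ch) (there e∈P) = chain-edge ch e∈P

  edge-rising : ∀ e → IsEdge F n e → rank m (ktail e) < rank m (khead e)
  edge-rising e ise = rising (edge-segment F n e ise)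

  head≡int : ∀ e w → T (khead e ==V int w) → rank m (khead e) ≡ w
  head≡int e w h = cong (rank m) (==V⇒≡ (khead e) (int w) h)

  visits⇒beyond-start : ∀ {v} P w → ChainFrom F n v P → T (visits P w) → rank m v < w
  visits⇒beyond-start (e ∷ P) w (refl , ise , ch) h with T-∨⁻ {khead e ==V int w} h
  ... | inj₁ at = subst (rank m (ktail e) <_) (head≡int e w at) (edge-rising e ise)
  ... | inj₂ later = <-trans (edge-rising e ise) (visits⇒beyond-start P w ch later)

  spanning-sound : ∀ P τ {e} → spanning P τ ≡ just e → e ∈ P × τ < rank m (khead e)
  spanning-sound P τ eq = let (τ< , e∈P) = findK-sound _ P eq in e∈P , <ᵇ⇒< τ _ τ<

  spanning-edge : ∀ {v} R τ {e} → ChainFrom F n v R → spanning R τ ≡ just e → IsEdge F n e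
  spanning-edge R τ ch eq = chain-edge ch (proj₁ (spanning-sound R τ eq))

  spanning-exists : ∀ {v} P τ → ChainFrom F n v P → rank m v ≤ τ → τ ≤ m →
    ∃ λ e → spanning P τ ≡ just e × rank m (ktail e) ≤ τ
  spanning-exists {snk _} [] τ _ m<τ τ≤m = ⊥-elim (<-irrefl refl (≤-trans m<τ τ≤m))
  spanning-exists (e ∷ P) τ (refl , ise , ch) v≤τ τ≤m with τ <ᵇ rank m (khead e) in τ<
  ... | true = e , refl , v≤τ
  ... | false = spanning-exists P τ ch (≮⇒≥ (≡false⇒¬T τ< ∘ <⇒<ᵇ)) τ≤m

  spanning-spans : ∀ {v} P τ {e} → ChainFrom F n v P → rank m v ≤ τ → τ ≤ m →
    spanning P τ ≡ just e → Spans m e τ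
  spanning-spans P τ ch v≤τ τ≤m eq with spanning-exists P τ ch v≤τ τ≤m
  ... | e , eq' , e≤τ with trans (sym eq) eq'
  ... | refl = e≤τ , proj₂ (spanning-sound P τ eq)

  spanning-head-visits : ∀ P τ w {e} → spanning P τ ≡ just e → T (khead e ==V int w) → T (visits P w)
  spanning-head-visits P τ w eq = any-∈ (λ e → khead e ==V int w) (proj₁ (spanning-sound P τ eq))

  inE≡spanning : ∀ {v} P τ → ChainFrom F n v P → rank m v ≤ τ → T (visits P (suc τ)) →
    inE P (suc τ) ≡ spanning P τ
  inE≡spanning (e ∷ P) τ (refl , ise , ch) v≤τ vis with khead e ==V int (suc τ) in hd | τ <ᵇ rank m (khead e) in τ<
  ... | true | true = refl
  ... | true | false = ⊥-elim (≡false⇒¬T τ< (<⇒<ᵇ (≤-reflexive (sym (head≡int e (suc τ) (≡true⇒T hd))))))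
  ... | false | true =
    ⊥-elim (<-irrefl refl (<-≤-trans (visits⇒beyond-start P (suc τ) ch vis) (<ᵇ⇒< τ _ (≡true⇒T τ<))))
  ... | false | false = inE≡spanning P τ ch (≤-pred (visits⇒beyond-start P (suc τ) ch vis)) vis

  visits⇒spanning-head : ∀ {v} P τ {e} → ChainFrom F n v P → rank m v ≤ τ → spanning P τ ≡ just e →
    T (visits P (suc τ)) → T (khead e ==V int (suc τ))
  visits⇒spanning-head P τ ch v≤τ eq vis =
    proj₁ (findK-sound _ P (trans (inE≡spanning P τ ch v≤τ vis) eq))

  outE≡spanning : ∀ {v} P w → ChainFrom F n v P → v ≡ int w ⊎ (rank m v < w × T (visits P w)) →
    outE P w ≡ spanning P w
  outE≡spanning {snk _} [] w _ (inj₂ (_ , ()))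
  outE≡spanning (e ∷ P) w (refl , ise , ch) (inj₁ tl) with ktail e ==V int w in tw | w <ᵇ rank m (khead e) in w<
  ... | true | true = refl
  ... | true | false =
    ⊥-elim (≡false⇒¬T w< (<⇒<ᵇ (subst (λ x → rank m x < rank m (khead e)) tl (edge-rising e ise))))
  ... | false | _ = ⊥-elim (≡false⇒¬T tw (subst (λ x → T (x ==V int w)) (sym tl) (==V-refl (int w))))
  outE≡spanning (e ∷ P) w (refl , ise , ch) (inj₂ (v<w , vis)) with ktail e ==V int w in tw
  ... | true = ⊥-elim (<-irrefl (cong (rank m) (==V⇒≡ (ktail e) (int w) (≡true⇒T tw))) v<w)
  ... | false with T-∨⁻ {khead e ==V int w} vis | w <ᵇ rank m (khead e) in w<
  ...   | inj₁ hd | true = ⊥-elim (<-irrefl (sym (head≡int e w hd)) (<ᵇ⇒< w _ (≡true⇒T w<)))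
  ...   | inj₁ hd | false = outE≡spanning P w ch (inj₁ (==V⇒≡ (khead e) (int w) hd))
  ...   | inj₂ later | true =
    ⊥-elim (<-irrefl refl (<-trans (visits⇒beyond-start P w ch later) (<ᵇ⇒< w _ (≡true⇒T w<))))
  ...   | inj₂ later | false = outE≡spanning P w ch (inj₂ (visits⇒beyond-start P w ch later , later))

  outE≡spanning-src : ∀ {a} P w → ChainFrom F n (src a) P → T (visits P w) → outE P w ≡ spanning P w
  outE≡spanning-src P w ch vis = outE≡spanning P w ch (inj₂ (visits⇒beyond-start P w ch vis , vis))

  spanning-beyond : ∀ P τ {e} → spanning P τ ≡ just e → (khead e ==V int (suc τ)) ≡ false → suc τ ≤ m →
    suc τ < rank m (khead e)
  spanning-beyond P τ {e} eq hd 1+τ≤m with m≤n⇒m<n∨m≡n (proj₂ (spanning-sound P τ eq))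
  ... | inj₁ 1+τ<hd = 1+τ<hd
  ... | inj₂ 1+τ≡hd =
    ⊥-elim (≡false⇒¬T hd (subst (λ x → T (x ==V int (suc τ))) (sym (rank≡ (khead e) 1+τ≡hd))
                                (==V-refl (int (suc τ)))))
    where
    rank≡ : ∀ x → suc τ ≡ rank m x → x ≡ int (suc τ)
    rank≡ (int w) refl = refl
    rank≡ (snk _) refl = ⊥-elim (<-irrefl refl 1+τ≤m)

  spanning-stays : ∀ P τ {e} → spanning P τ ≡ just e → (khead e ==V int (suc τ)) ≡ false → suc τ ≤ m →
    spanning P (suc τ) ≡ just e
  spanning-stays P τ eq hd 1+τ≤m =
    findK-weaken _ _ P (λ x 1+τ< → <⇒<ᵇ (<-trans (n<1+n τ) (<ᵇ⇒< (suc τ) (rank m (khead x)) 1+τ<))) eq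
                 (<⇒<ᵇ (spanning-beyond P τ eq hd 1+τ≤m))

  spanning-moves : ∀ {v} P τ {e} → ChainFrom F n v P → rank m v ≤ τ → spanning P τ ≡ just e →
    T (khead e ==V int (suc τ)) → suc τ ≤ m →
    ∃ λ e' → spanning P (suc τ) ≡ just e' × outE P (suc τ) ≡ just e' × ktail e' ≡ int (suc τ)
  spanning-moves P τ ch v≤τ eq hd 1+τ≤m with spanning-exists P (suc τ) ch (≤-trans v≤τ (n≤1+n τ)) 1+τ≤m
  ... | e' , eq' , _ = e' , eq' , out , ==V⇒≡ (ktail e') (int (suc τ)) (proj₁ (findK-sound _ P out))
    where
    out = trans (outE≡spanning P (suc τ) ch (inj₂ (s≤s v≤τ , spanning-head-visits P τ (suc τ) eq hd))) eq'

  chain-tail : ∀ {v} R {e} → ChainFrom F n v R → e ∈ R → ktail e ≡ v ⊎ rank m v < rank m (ktail e)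
  chain-tail (x ∷ R) (refl , _ , _) (here refl) = inj₁ refl
  chain-tail (x ∷ R) (refl , ise , ch) (there e∈R) with chain-tail R ch e∈R
  ... | inj₁ refl = inj₂ (edge-rising x ise)
  ... | inj₂ later = inj₂ (<-trans (edge-rising x ise) later)

  spanning-zero-label : ∀ {a} P {e} → ChainFrom F n (src a) P → spanning P 0 ≡ just e → klabel e ≡ a
  spanning-zero-label P {e} ch eq
    with chain-tail P ch (proj₁ (spanning-sound P 0 eq)) | proj₁ (spanning-spans P 0 ch z≤n z≤n eq)
  ... | inj₂ 0<tl | tl≤0 = ⊥-elim (<-irrefl refl (<-≤-trans 0<tl tl≤0))
  ... | inj₁ tl≡ | _ = from-tail (ktail e) tl≡ (tail-on (edge-segment F n e (spanning-edge P 0 ch eq)))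
    where
    from-tail : ∀ {a} x → x ≡ src a → TailOf F (klabel e) x → klabel e ≡ a
    from-tail _ refl a≡ = sym a≡

  inE-via-spanning : ∀ {a} R τ {e} → ChainFrom F n (src a) R → T (visits R (suc τ)) → spanning R τ ≡ just e →
    inE R (suc τ) ≡ just e
  inE-via-spanning R τ ch vis eq = trans (inE≡spanning R τ ch z≤n vis) eq

  passing⇒¬visits : ∀ {a} R τ {e} → ChainFrom F n (src a) R → spanning R τ ≡ just e →
    (khead e ==V int (suc τ)) ≡ false → visits R (suc τ) ≡ false
  passing⇒¬visits R τ ch eq hd = ¬T⇒≡false (≡false⇒¬T hd ∘ visits⇒spanning-head R τ ch z≤n eq)

  labels-around : ∀ w {e e' d} → IsEdge F n e → khead e ≡ int w → IsEdge F n e' → ktail e' ≡ int w →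
    IsEdge F n d → rank m (ktail d) < w → w < rank m (khead d) → w ≤ m →
    (klabel e < klabel d → klabel e' < klabel d) × (klabel d < klabel e → klabel d < klabel e')
  labels-around w {e} {e'} {d} ise hd ise' tl isd d<w w<d w≤m =
    memb-convex F w (proj₁ (subst (HeadOf F (klabel e)) hd (head-on (edge-segment F n e ise))))
                    (proj₁ (subst (TailOf F (klabel e')) tl (tail-on (edge-segment F n e' ise'))))
                    (skips (edge-segment F n d isd) w d<w w<d w≤m)

  entering-edge : ∀ {v} R κ {e} → ChainFrom F n v R → inE R (suc κ) ≡ just e → IsEdge F n e × Spans m e κ
  entering-edge R κ {e} ch eq = ise , ≤-pred (subst (rank m (ktail e) <_) head≡ (edge-rising e ise)) ,
                                      subst (κ <_) (sym head≡) (n<1+n κ)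
    where
    ise = chain-edge ch (proj₂ (findK-sound _ R eq))
    head≡ = head≡int e (suc κ) (proj₁ (findK-sound _ R eq))

  inE-unique : ∀ {v v'} R R' k → ChainFrom F n v R → ChainFrom F n v' R' → T (visits R k) → T (visits R' k) →
    pos (inE R k) ≡ pos (inE R' k) → inE R k ≡ inE R' k
  inE-unique R R' zero ch _ vis _ _ = ⊥-elim (<-irrefl refl (≤-<-trans z≤n (visits⇒beyond-start R 0 ch vis)))
  inE-unique R R' (suc κ) ch ch' vis vis' same-pos
    with findK-complete _ R vis | findK-complete _ R' vis'
  ... | e , in≡ | e' , in≡' = trans in≡ (trans (cong just e≡e') (sym in≡'))
    where
    e≡e' : e ≡ e'
    e≡e' with entering-edge R κ ch in≡ | entering-edge R' κ ch' in≡'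
    ... | ise , spans | ise' , spans' =
      edge-unique F n κ ise ise' (subst₂ (λ x y → pos x ≡ pos y) in≡ in≡' same-pos) spans spans'

  spanning-label-injective : ∀ {a b} P Q τ {e e'} → ChainFrom F n (src a) P → ChainFrom F n (src b) Q → τ ≤ m →
    spanning P τ ≡ just e → spanning Q τ ≡ just e' → klabel e ≡ klabel e' → e ≡ e'
  spanning-label-injective P Q τ chP chQ τ≤m eq eq' same-label =
    edge-unique F n τ (spanning-edge P τ chP eq) (spanning-edge Q τ chQ eq') same-label
      (spanning-spans P τ chP z≤n τ≤m eq) (spanning-spans Q τ chQ z≤n τ≤m eq')

module Crossings (F : StarNet) (n : ℕ) (P Q : Path) where
  open Chains F n

  crossings : ℕ → ℕ
  crossings τ = length (filterᵇ (crossAt F P Q) (from1 τ))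

  crossings-suc : ∀ τ → crossings (suc τ) ≡ crossings τ + (if crossAt F P Q (suc τ) then 1 else 0)
  crossings-suc τ = begin
    length (filterᵇ p (from1 (suc τ)))                   ≡⟨ cong (length ∘ filterᵇ p) (from1-∷ʳ τ) ⟩
    length (filterᵇ p (from1 τ ++ [ suc τ ]))             ≡⟨ cong length (filterᵇ-++ p (from1 τ) [ suc τ ]) ⟩
    length (filterᵇ p (from1 τ) ++ filterᵇ p [ suc τ ])  ≡⟨ length-++ (filterᵇ p (from1 τ)) ⟩
    crossings τ + length (filterᵇ p [ suc τ ])            ≡⟨ cong (crossings τ +_) (length-filterᵇ-singleton p (suc τ)) ⟩
    crossings τ + (if p (suc τ) then 1 else 0)            ∎
    where
    open ≡-Reasoning
    p = crossAt F P Q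

  crossings-suc-¬cross : ∀ τ → crossAt F P Q (suc τ) ≡ false → crossings (suc τ) ≡ crossings τ
  crossings-suc-¬cross τ ¬cr rewrite crossings-suc τ | ¬cr = +-identityʳ _

  odd-crossings-suc : ∀ τ → oddᵇ (crossings (suc τ)) ≡ oddᵇ (crossings τ) xor crossAt F P Q (suc τ)
  odd-crossings-suc τ rewrite crossings-suc τ with crossAt F P Q (suc τ)
  ... | true = trans (cong oddᵇ (+-comm (crossings τ) 1))
                     (sym (trans (xor-comm (oddᵇ (crossings τ)) true) (true-xor _)))
  ... | false = trans (cong oddᵇ (+-identityʳ (crossings τ))) (sym (xor-identityʳ (oddᵇ (crossings τ))))

  meets⇒visits : ∀ {w} → T (meets P Q w) → T (visits P w) × T (visits Q w)
  meets⇒visits {w} mt = let (vP , rest) = T-∧⁻ mt in vP , proj₁ (T-∧⁻ {visits Q w} rest)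

  meets-intro : ∀ w {a b} → T (visits P w) → T (visits Q w) → inE P w ≡ just a → inE Q w ≡ just b → a ≢ b →
    meets P Q w ≡ true
  meets-intro w {a} {b} vP vQ inP inQ a≢b
    rewrite T⇒≡true vP | T⇒≡true vQ | inP | inQ | ≢⇒==K-false a b a≢b = refl

  same-inE⇒¬meets : ∀ w → inE P w ≡ inE Q w → meets P Q w ≡ false
  same-inE⇒¬meets w same with visits P w | visits Q w
  ... | false | _ = refl
  ... | true | false = refl
  ... | true | true rewrite same | ==MK-refl (inE Q w) = refl

  ¬visits⇒¬meets : ∀ w → visits P w ≡ false ⊎ visits Q w ≡ false → meets P Q w ≡ false
  ¬visits⇒¬meets w (inj₁ ¬vP) rewrite ¬vP = refl
  ¬visits⇒¬meets w (inj₂ ¬vQ) rewrite ¬vQ with visits P w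
  ... | true = refl
  ... | false = refl

  ¬meets⇒¬crossAt : ∀ w → meets P Q w ≡ false → crossAt F P Q w ≡ false
  ¬meets⇒¬crossAt w ¬mt with finalFrom F P Q w
  ... | just l rewrite ¬mt = refl
  ... | nothing = refl

  crossAt⇒meets : ∀ w → T (crossAt F P Q w) → T (meets P Q w)
  crossAt⇒meets w cr with finalFrom F P Q w
  ... | just l = proj₁ (T-∧⁻ cr)

  crossAt-final : ∀ w l → finalFrom F P Q w ≡ just l →
    crossAt F P Q w ≡ meets P Q w ∧ ((pos (inE P w) <ᵇ pos (inE Q w)) xor (pos (outE P l) <ᵇ pos (outE Q l)))
  crossAt-final w l eq with finalFrom F P Q w
  crossAt-final w l refl | .(just l) = refl

  parts : ℕ → ℕ → Bool
  parts j l = (j ≤ᵇ l) ∧ visits P l ∧ visits Q l ∧ not (outE P l ==MK outE Q l)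

  parts-intro : ∀ j l {a b} → j ≤ l → T (visits P l) → T (visits Q l) →
    outE P l ≡ just a → outE Q l ≡ just b → a ≢ b → T (parts j l)
  parts-intro j l {a} {b} j≤l vP vQ outP outQ a≢b
    rewrite T⇒≡true (≤⇒≤ᵇ j≤l) | T⇒≡true vP | T⇒≡true vQ | outP | outQ | ≢⇒==K-false a b a≢b = tt

  ¬parts-before : ∀ j l → l < j → parts j l ≡ false
  ¬parts-before j l l<j rewrite ¬T⇒≡false (λ j≤l → <-irrefl refl (<-≤-trans l<j (≤ᵇ⇒≤ j l j≤l))) = refl

  ¬parts-together : ∀ j l → (T (visits P l) → T (visits Q l) → outE P l ≡ outE Q l) → parts j l ≡ false
  ¬parts-together j l together with visits P l in vP | visits Q l in vQ
  ... | false | _ = ∧-zeroʳ (j ≤ᵇ l)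
  ... | true | false = ∧-zeroʳ (j ≤ᵇ l)
  ... | true | true rewrite together tt tt | ==MK-refl (outE Q l) = ∧-zeroʳ (j ≤ᵇ l)

  finalFrom-complete : ∀ j l → 1 ≤ j → j ≤ l → l ≤ m → T (parts j l) →
    (∀ l' → 1 ≤ l' → l' < l → parts j l' ≡ false) → finalFrom F P Q j ≡ just l
  finalFrom-complete j l 1≤j j≤l l≤m pl before =
    trans (cong (firstM (parts j)) (from1-range m))
          (firstM-range-complete (parts j) m 1 l (≤-trans 1≤j j≤l) (s≤s l≤m) pl before)

  finalFrom-sound : ∀ j l → 1 ≤ j → finalFrom F P Q j ≡ just l →
    T (visits P l) × T (visits Q l) ×
    (∀ l' → j ≤ l' → l' < l → T (visits P l') → T (visits Q l') → outE P l' ≡ outE Q l')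
  finalFrom-sound j l 1≤j eq
    with firstM-range-sound (parts j) m 1 l (trans (cong (firstM (parts j)) (sym (from1-range m))) eq)
  ... | _ , pl , before = vP , vQ , together
    where
    pl' = proj₂ (T-∧⁻ {j ≤ᵇ l} pl)
    vP = proj₁ (T-∧⁻ pl')
    vQ = proj₁ (T-∧⁻ (proj₂ (T-∧⁻ {visits P l} pl')))
    together : ∀ l' → j ≤ l' → l' < l → T (visits P l') → T (visits Q l') → outE P l' ≡ outE Q l'
    together l' j≤l' l'<l vP' vQ' with before l' (≤-trans 1≤j j≤l') l'<l
    ... | ¬pl' rewrite T⇒≡true (≤⇒≤ᵇ j≤l') | T⇒≡true vP' | T⇒≡true vQ'
      with outE P l' ==MK outE Q l' in same
    ...   | true = ==MK⇒≡ _ _ (≡true⇒T same)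

data Oriented : Bool → ℕ → ℕ → Set where
  kept : ∀ {x y} → x < y → Oriented false x y
  swapped : ∀ {x y} → y < x → Oriented true x y

oriented⇒xor : ∀ {b x y} → Oriented b x y → b xor (x <ᵇ y) ≡ true
oriented⇒xor (kept x<y) = T⇒≡true (<⇒<ᵇ x<y)
oriented⇒xor {x = x} {y} (swapped y<x) = cong not (¬T⇒≡false (<-asym y<x ∘ <ᵇ⇒< x y))

distinct⇒oriented : ∀ {a c} → a ≢ c → Oriented (not (a <ᵇ c)) a c
distinct⇒oriented {a} {c} a≢c with <-cmp a c
... | tri< a<c _ _ = subst (λ β → Oriented (not β) a c) (sym (T⇒≡true (<⇒<ᵇ a<c))) (kept a<c)
... | tri≈ _ a≡c _ = ⊥-elim (a≢c a≡c)
... | tri> _ _ c<a = subst (λ β → Oriented (not β) a c) (sym (¬T⇒≡false (<-asym c<a ∘ <ᵇ⇒< a c))) (swapped c<a)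

-- b is the parity of the crossings before a component entered in label order (x, y) and left in
-- order (a, c); that component is a crossing iff the two orders differ.
oriented-transfer : ∀ {b x y a c} → Oriented b x y → a ≢ c → Oriented (b xor ((x <ᵇ y) xor (a <ᵇ c))) a c
oriented-transfer {b} {x} {y} {a} {c} o a≢c = subst (λ β → Oriented β a c) (sym parity) (distinct⇒oriented a≢c)
  where
  open ≡-Reasoning
  parity : b xor ((x <ᵇ y) xor (a <ᵇ c)) ≡ not (a <ᵇ c)
  parity = begin
    b xor ((x <ᵇ y) xor (a <ᵇ c))  ≡⟨ sym (xor-assoc b (x <ᵇ y) (a <ᵇ c)) ⟩
    (b xor (x <ᵇ y)) xor (a <ᵇ c)  ≡⟨ cong (_xor (a <ᵇ c)) (oriented⇒xor o) ⟩
    not (a <ᵇ c)                    ∎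

oriented-moveˡ : ∀ {b x y z} → (x < z → y < z) × (z < x → z < y) → Oriented b x z → Oriented b y z
oriented-moveˡ (up , _) (kept x<z) = kept (up x<z)
oriented-moveˡ (_ , down) (swapped z<x) = swapped (down z<x)

oriented-moveʳ : ∀ {b x y z} → (x < z → y < z) × (z < x → z < y) → Oriented b z x → Oriented b z y
oriented-moveʳ (_ , down) (kept z<x) = kept (down z<x)
oriented-moveʳ (up , _) (swapped x<z) = swapped (up x<z)

oriented-true : ∀ {b x y} → Oriented b x y → T b → y < x
oriented-true (swapped y<x) _ = y<x

module ChainPair (F : StarNet) (n : ℕ) (P Q : Path) {i j : ℕ}
              (chP : ChainFrom F n (src i) P) (chQ : ChainFrom F n (src j) Q) where
  open Chains F n
  open Crossings F n P Q

  -- P and Q have run on common edges since they met at x_(start+1).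
  record Shared (τ : ℕ) : Set where
    field
      start : ℕ
      start<τ : start < τ
      met : T (meets P Q (suc start))
      together : ∀ l → suc start ≤ l → l ≤ τ → spanning P l ≡ spanning Q l
      no-crossings : crossings τ ≡ crossings (suc start)
      entry : Oriented (oddᵇ (crossings start)) (pos (inE P (suc start))) (pos (inE Q (suc start)))

  data State (eP eQ : Key) (τ : ℕ) : Set where
    apart : eP ≢ eQ → Oriented (oddᵇ (crossings τ)) (klabel eP) (klabel eQ) → State eP eQ τ
    joint : eP ≡ eQ → Shared τ → State eP eQ τ

  record Invariant (τ : ℕ) : Set where
    constructor invariant
    field
      eP eQ : Key
      spanP : spanning P τ ≡ just eP
      spanQ : spanning Q τ ≡ just eQ
      state : State eP eQ τ

  NoMeeting : ℕ → Set
  NoMeeting w = visits P w ≡ false ⊎ visits Q w ≡ false ⊎ inE P w ≡ inE Q w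

  uncrossed : ∀ τ → NoMeeting (suc τ) → crossings (suc τ) ≡ crossings τ
  uncrossed τ reason = crossings-suc-¬cross τ (¬meets⇒¬crossAt (suc τ) (¬meets reason))
    where
    ¬meets : NoMeeting (suc τ) → meets P Q (suc τ) ≡ false
    ¬meets (inj₁ ¬vP) = ¬visits⇒¬meets (suc τ) (inj₁ ¬vP)
    ¬meets (inj₂ (inj₁ ¬vQ)) = ¬visits⇒¬meets (suc τ) (inj₂ ¬vQ)
    ¬meets (inj₂ (inj₂ same)) = same-inE⇒¬meets (suc τ) same

  oriented-uncrossed : ∀ τ {x y} → crossings (suc τ) ≡ crossings τ →
    Oriented (oddᵇ (crossings τ)) x y → Oriented (oddᵇ (crossings (suc τ))) x y
  oriented-uncrossed τ {x} {y} same = subst (λ c → Oriented (oddᵇ c) x y) (sym same)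

  shared-extend : ∀ {τ} → Shared τ → spanning P (suc τ) ≡ spanning Q (suc τ) →
    crossings (suc τ) ≡ crossings τ → Shared (suc τ)
  shared-extend {τ} sh same-span same-count = record
    { start = start ; start<τ = <-trans start<τ (n<1+n τ) ; met = met ; together = together'
    ; no-crossings = trans same-count no-crossings ; entry = entry }
    where
    open Shared sh
    together' : ∀ l → suc start ≤ l → l ≤ suc τ → spanning P l ≡ spanning Q l
    together' l lo hi with m≤n⇒m<n∨m≡n hi
    ... | inj₁ l<1+τ = together l lo (≤-pred l<1+τ)
    ... | inj₂ refl = same-span

  step-neither : ∀ τ → suc τ ≤ m → ∀ {eP eQ} → spanning P τ ≡ just eP → spanning Q τ ≡ just eQ →
    (khead eP ==V int (suc τ)) ≡ false → (khead eQ ==V int (suc τ)) ≡ false → State eP eQ τ → Invariant (suc τ)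
  step-neither τ le {eP} {eQ} spP spQ hP hQ st = invariant eP eQ spP' spQ' (carry st)
    where
    spP' = spanning-stays P τ spP hP le
    spQ' = spanning-stays Q τ spQ hQ le
    same = uncrossed τ (inj₁ (passing⇒¬visits P τ chP spP hP))
    carry : State eP eQ τ → State eP eQ (suc τ)
    carry (apart ne o) = apart ne (oriented-uncrossed τ same o)
    carry (joint refl sh) = joint refl (shared-extend sh (trans spP' (sym spQ')) same)

  step-P-enters : ∀ τ → suc τ ≤ m → ∀ {eP eQ} → spanning P τ ≡ just eP → spanning Q τ ≡ just eQ →
    T (khead eP ==V int (suc τ)) → (khead eQ ==V int (suc τ)) ≡ false → State eP eQ τ → Invariant (suc τ)
  step-P-enters τ le spP spQ hP hQ (joint refl _) = ⊥-elim (≡false⇒¬T hQ hP)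
  step-P-enters τ le {eP} {eQ} spP spQ hP hQ (apart _ o) with spanning-moves P τ chP z≤n spP hP le
  ... | eP' , spP' , _ , tl' =
    invariant eP' eQ spP' spQ' (apart distinct (oriented-uncrossed τ same (oriented-moveˡ around o)))
    where
    spQ' = spanning-stays Q τ spQ hQ le
    same = uncrossed τ (inj₂ (inj₁ (passing⇒¬visits Q τ chQ spQ hQ)))
    Q-tail = proj₁ (spanning-spans Q τ chQ z≤n (≤-trans (n≤1+n τ) le) spQ)
    distinct : eP' ≢ eQ
    distinct refl = <-irrefl refl (≤-<-trans (subst (λ x → rank m x ≤ τ) tl' Q-tail) (n<1+n τ))
    around = labels-around (suc τ) {eP} {eP'} {eQ}
               (spanning-edge P τ chP spP) (==V⇒≡ (khead eP) (int (suc τ)) hP) (spanning-edge P (suc τ) chP spP') tl'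
               (spanning-edge Q τ chQ spQ) (s≤s Q-tail) (spanning-beyond Q τ spQ hQ le) le

  step-Q-enters : ∀ τ → suc τ ≤ m → ∀ {eP eQ} → spanning P τ ≡ just eP → spanning Q τ ≡ just eQ →
    (khead eP ==V int (suc τ)) ≡ false → T (khead eQ ==V int (suc τ)) → State eP eQ τ → Invariant (suc τ)
  step-Q-enters τ le spP spQ hP hQ (joint refl _) = ⊥-elim (≡false⇒¬T hP hQ)
  step-Q-enters τ le {eP} {eQ} spP spQ hP hQ (apart _ o) with spanning-moves Q τ chQ z≤n spQ hQ le
  ... | eQ' , spQ' , _ , tl' =
    invariant eP eQ' spP' spQ' (apart distinct (oriented-uncrossed τ same (oriented-moveʳ around o)))
    where
    spP' = spanning-stays P τ spP hP le
    same = uncrossed τ (inj₁ (passing⇒¬visits P τ chP spP hP))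
    P-tail = proj₁ (spanning-spans P τ chP z≤n (≤-trans (n≤1+n τ) le) spP)
    distinct : eP ≢ eQ'
    distinct refl = <-irrefl refl (≤-<-trans (subst (λ x → rank m x ≤ τ) tl' P-tail) (n<1+n τ))
    around = labels-around (suc τ) {eQ} {eQ'} {eP}
               (spanning-edge Q τ chQ spQ) (==V⇒≡ (khead eQ) (int (suc τ)) hQ) (spanning-edge Q (suc τ) chQ spQ') tl'
               (spanning-edge P τ chP spP) (s≤s P-tail) (spanning-beyond P τ spP hP le) le

  step-meet : ∀ τ → suc τ ≤ m → ∀ {eP eQ} → spanning P τ ≡ just eP → spanning Q τ ≡ just eQ →
    T (khead eP ==V int (suc τ)) → T (khead eQ ==V int (suc τ)) →
    eP ≢ eQ → Oriented (oddᵇ (crossings τ)) (klabel eP) (klabel eQ) → Invariant (suc τ)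
  step-meet τ le {eP} {eQ} spP spQ hP hQ ne o
    with spanning-moves P τ chP z≤n spP hP le | spanning-moves Q τ chQ z≤n spQ hQ le
  ... | eP' , spP' , outP , _ | eQ' , spQ' , outQ , _ = invariant eP' eQ' spP' spQ' next
    where
    vP = spanning-head-visits P τ (suc τ) spP hP
    vQ = spanning-head-visits Q τ (suc τ) spQ hQ
    inP = inE-via-spanning P τ chP vP spP
    inQ = inE-via-spanning Q τ chQ vQ spQ
    mt = meets-intro (suc τ) vP vQ inP inQ ne
    next : State eP' eQ' (suc τ)
    next with eP' ≟K eQ'
    ... | yes refl = joint refl (record
      { start = τ ; start<τ = n<1+n τ ; met = ≡true⇒T mt
      ; together = λ l lo hi → subst (λ l → spanning P l ≡ spanning Q l) (≤-antisym lo hi) (trans spP' (sym spQ'))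
      ; no-crossings = refl
      ; entry = subst₂ (λ a b → Oriented (oddᵇ (crossings τ)) (pos a) (pos b)) (sym inP) (sym inQ) o })
    ... | no ne' = apart ne' (subst (λ β → Oriented β _ _) (sym parity) (oriented-transfer o label-ne))
      where
      final : finalFrom F P Q (suc τ) ≡ just (suc τ)
      final = finalFrom-complete (suc τ) (suc τ) (s≤s z≤n) ≤-refl le
                (parts-intro (suc τ) (suc τ) ≤-refl vP vQ outP outQ ne') (λ l' _ → ¬parts-before (suc τ) l')
      cross : crossAt F P Q (suc τ) ≡ (klabel eP <ᵇ klabel eQ) xor (klabel eP' <ᵇ klabel eQ')
      cross rewrite crossAt-final (suc τ) (suc τ) final | mt | inP | inQ | outP | outQ = refl
      parity : oddᵇ (crossings (suc τ)) ≡
               oddᵇ (crossings τ) xor ((klabel eP <ᵇ klabel eQ) xor (klabel eP' <ᵇ klabel eQ'))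
      parity = trans (odd-crossings-suc τ) (cong (oddᵇ (crossings τ) xor_) cross)
      label-ne : klabel eP' ≢ klabel eQ'
      label-ne = ne' ∘ spanning-label-injective P Q (suc τ) chP chQ le spP' spQ'

  step-joint : ∀ τ → suc τ ≤ m → ∀ {e} → spanning P τ ≡ just e → spanning Q τ ≡ just e →
    T (khead e ==V int (suc τ)) → Shared τ → Invariant (suc τ)
  step-joint τ le spP spQ hd sh
    with spanning-moves P τ chP z≤n spP hd le | spanning-moves Q τ chQ z≤n spQ hd le
  ... | eP' , spP' , outP , _ | eQ' , spQ' , outQ , _ = invariant eP' eQ' spP' spQ' next
    where
    open Shared sh
    vP = spanning-head-visits P τ (suc τ) spP hd
    vQ = spanning-head-visits Q τ (suc τ) spQ hd
    same = uncrossed τ (inj₂ (inj₂ (trans (inE-via-spanning P τ chP vP spP) (sym (inE-via-spanning Q τ chQ vQ spQ)))))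
    next : State eP' eQ' (suc τ)
    next with eP' ≟K eQ'
    ... | yes refl = joint refl (shared-extend sh (trans spP' (sym spQ')) same)
    ... | no ne' = apart ne' (subst (λ β → Oriented β _ _) (sym parity) (oriented-transfer entry label-ne))
      where
      before : ∀ l' → 1 ≤ l' → l' < suc τ → parts (suc start) l' ≡ false
      before l' 1≤l' l'<1+τ with <-≤-connex l' (suc start)
      ... | inj₁ l'<s = ¬parts-before (suc start) l' l'<s
      ... | inj₂ s≤l' = ¬parts-together (suc start) l' λ vP' vQ' →
            trans (outE≡spanning-src P l' chP vP')
                  (trans (together l' s≤l' (≤-pred l'<1+τ)) (sym (outE≡spanning-src Q l' chQ vQ')))
      final : finalFrom F P Q (suc start) ≡ just (suc τ)
      final = finalFrom-complete (suc start) (suc τ) (s≤s z≤n) (≤-trans start<τ (n≤1+n τ)) le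
                (parts-intro (suc start) (suc τ) (≤-trans start<τ (n≤1+n τ)) vP vQ outP outQ ne') before
      entered = pos (inE P (suc start)) <ᵇ pos (inE Q (suc start))
      cross : crossAt F P Q (suc start) ≡ entered xor (klabel eP' <ᵇ klabel eQ')
      cross rewrite crossAt-final (suc start) (suc τ) final | T⇒≡true met | outP | outQ = refl
      -- the crossing of the component now ending is counted at its initial vertex x_(start+1)
      parity : oddᵇ (crossings (suc τ)) ≡ oddᵇ (crossings start) xor (entered xor (klabel eP' <ᵇ klabel eQ'))
      parity = trans (cong oddᵇ (trans same no-crossings))
                     (trans (odd-crossings-suc start) (cong (oddᵇ (crossings start) xor_) cross))
      label-ne : klabel eP' ≢ klabel eQ'
      label-ne = ne' ∘ spanning-label-injective P Q (suc τ) chP chQ le spP' spQ'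

  step-both : ∀ τ → suc τ ≤ m → ∀ {eP eQ} → spanning P τ ≡ just eP → spanning Q τ ≡ just eQ →
    T (khead eP ==V int (suc τ)) → T (khead eQ ==V int (suc τ)) → State eP eQ τ → Invariant (suc τ)
  step-both τ le spP spQ hP hQ (apart ne o) = step-meet τ le spP spQ hP hQ ne o
  step-both τ le spP spQ hP _ (joint refl sh) = step-joint τ le spP spQ hP sh

  step : ∀ τ → suc τ ≤ m → Invariant τ → Invariant (suc τ)
  step τ le (invariant eP eQ spP spQ st) with khead eP ==V int (suc τ) in hP | khead eQ ==V int (suc τ) in hQ
  ... | false | false = step-neither τ le spP spQ hP hQ st
  ... | true | false = step-P-enters τ le spP spQ (≡true⇒T hP) hQ st
  ... | false | true = step-Q-enters τ le spP spQ hP (≡true⇒T hQ) st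
  ... | true | true = step-both τ le spP spQ (≡true⇒T hP) (≡true⇒T hQ) st

  initial : i < j → Invariant 0
  initial i<j with spanning-exists P 0 chP z≤n z≤n | spanning-exists Q 0 chQ z≤n z≤n
  ... | eP , spP , _ | eQ , spQ , _ = invariant eP eQ spP spQ (apart (λ { refl → <-irrefl refl P<Q }) (kept P<Q))
    where
    P<Q : klabel eP < klabel eQ
    P<Q = subst₂ _<_ (sym (spanning-zero-label P chP spP)) (sym (spanning-zero-label Q chQ spQ)) i<j

  invariant-upto : i < j → ∀ τ → τ ≤ m → Invariant τ
  invariant-upto i<j zero _ = initial i<j
  invariant-upto i<j (suc τ) le = step τ le (invariant-upto i<j τ (≤-trans (n≤1+n τ) le))

  odd-crossings⇒swapped : i < j → ∀ k → k ≤ m → T (meets P Q k) → T (oddᵇ (crossCount F P Q k)) →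
    pos (inE Q k) < pos (inE P k)
  odd-crossings⇒swapped _ zero _ mt _ =
    ⊥-elim (<-irrefl refl (≤-<-trans z≤n (visits⇒beyond-start P 0 chP (proj₁ (meets⇒visits mt)))))
  odd-crossings⇒swapped i<j (suc τ) le mt odd with invariant-upto i<j τ (≤-trans (n≤1+n τ) le)
  ... | invariant eP eQ spP spQ st = conclude st
    where
    inP = inE-via-spanning P τ chP (proj₁ (meets⇒visits mt)) spP
    inQ = inE-via-spanning Q τ chQ (proj₂ (meets⇒visits mt)) spQ
    conclude : State eP eQ τ → pos (inE Q (suc τ)) < pos (inE P (suc τ))
    conclude (apart _ o) = subst₂ _<_ (cong pos (sym inQ)) (cong pos (sym inP)) (oriented-true o odd)
    conclude (joint refl _) = ⊥-elim (≡false⇒¬T (same-inE⇒¬meets (suc τ) (trans inP (sym inQ))) mt)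

  crossing-ends-before : ∀ {j₀ l} k → 1 ≤ j₀ → j₀ < k → k ≤ m → T (crossAt F P Q j₀) →
    finalFrom F P Q j₀ ≡ just l → T (meets P Q k) → l < k
  crossing-ends-before {j₀} {l} (suc κ) 1≤j₀ (s≤s j₀≤κ) k≤m cr final mt = ≰⇒> apart-at-k
    where
    vP₀ = proj₁ (meets⇒visits (crossAt⇒meets j₀ cr))
    vQ₀ = proj₂ (meets⇒visits (crossAt⇒meets j₀ cr))
    leave-alike = proj₂ (proj₂ (finalFrom-sound j₀ l 1≤j₀ final))
    below-m : ∀ {w} → w ≤ κ → w ≤ m
    below-m w≤κ = ≤-trans w≤κ (≤-trans (n≤1+n κ) k≤m)
    module _ (k≤l : suc κ ≤ l) where
      leave-together : ∀ w → j₀ ≤ w → w ≤ κ → T (visits P w) → T (visits Q w) → spanning P w ≡ spanning Q w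
      leave-together w j₀≤w w≤κ vP vQ =
        trans (sym (outE≡spanning-src P w chP vP))
              (trans (leave-alike w j₀≤w (≤-<-trans w≤κ k≤l) vP vQ) (outE≡spanning-src Q w chQ vQ))
      step-together : ∀ τ → j₀ ≤ τ → suc τ ≤ κ → spanning P τ ≡ spanning Q τ →
        spanning P (suc τ) ≡ spanning Q (suc τ)
      step-together τ j₀≤τ 1+τ≤κ same with spanning-exists P τ chP z≤n (<⇒≤ (below-m 1+τ≤κ))
      ... | eP , spP , _ with khead eP ==V int (suc τ) in hd
      ...   | false = trans (spanning-stays P τ spP hd (below-m 1+τ≤κ))
                            (sym (spanning-stays Q τ (trans (sym same) spP) hd (below-m 1+τ≤κ)))
      ...   | true = leave-together (suc τ) (≤-trans j₀≤τ (n≤1+n τ)) 1+τ≤κ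
                       (spanning-head-visits P τ (suc τ) spP (≡true⇒T hd))
                       (spanning-head-visits Q τ (suc τ) (trans (sym same) spP) (≡true⇒T hd))
      run-together : ∀ τ → j₀ ≤ τ → τ ≤ κ → spanning P τ ≡ spanning Q τ
      run-together zero j₀≤0 _ = ⊥-elim (<-irrefl refl (≤-trans 1≤j₀ j₀≤0))
      run-together (suc τ) j₀≤1+τ 1+τ≤κ with m≤n⇒m<n∨m≡n j₀≤1+τ
      ... | inj₂ j₀≡ =
        leave-together (suc τ) j₀≤1+τ 1+τ≤κ (subst (T ∘ visits P) j₀≡ vP₀) (subst (T ∘ visits Q) j₀≡ vQ₀)
      ... | inj₁ (s≤s j₀≤τ) =
        step-together τ j₀≤τ 1+τ≤κ (run-together τ j₀≤τ (≤-trans (n≤1+n τ) 1+τ≤κ))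
      apart-at-k : ⊥
      apart-at-k = ≡false⇒¬T (same-inE⇒¬meets (suc κ) same-entry) mt
        where
        same-entry = trans (inE≡spanning P κ chP z≤n (proj₁ (meets⇒visits mt)))
                     (trans (run-together κ j₀≤κ ≤-refl)
                            (sym (inE≡spanning Q κ chQ z≤n (proj₂ (meets⇒visits mt)))))

module Swapping (F : StarNet) (n : ℕ) where
  open Chains F n

  ChainTo : V → V → Path → Set
  ChainTo v w [] = v ≡ w
  ChainTo v w (e ∷ R) = ktail e ≡ v × IsEdge F n e × ChainTo (khead e) w R

  chain-++ : ∀ {v w} A {B} → ChainTo v w A → ChainFrom F n w B → ChainFrom F n v (A ++ B)
  chain-++ [] refl chB = chB
  chain-++ (e ∷ A) (tl , ise , chA) chB = tl , ise , chain-++ A chA chB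

  upToV-++-afterV : ∀ v R → upToV v R ++ afterV v R ≡ R
  upToV-++-afterV v [] = refl
  upToV-++-afterV v (e ∷ R) with khead e ==V v
  ... | true = refl
  ... | false = cong (e ∷_) (upToV-++-afterV v R)

  upToV-chain : ∀ {v} R w → ChainFrom F n v R → T (visits R w) → ChainTo v (int w) (upToV (int w) R)
  upToV-chain (e ∷ R) w (refl , ise , ch) vis with khead e ==V int w in hd
  ... | true = refl , ise , ==V⇒≡ (khead e) (int w) (≡true⇒T hd)
  ... | false = refl , ise , upToV-chain R w ch vis

  afterV-chain : ∀ {v} R w → ChainFrom F n v R → T (visits R w) → ChainFrom F n (int w) (afterV (int w) R)
  afterV-chain (e ∷ R) w (refl , ise , ch) vis with khead e ==V int w in hd
  ... | true = subst (λ x → ChainFrom F n x R) (==V⇒≡ (khead e) (int w) (≡true⇒T hd)) ch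
  ... | false = afterV-chain R w ch vis

  upToV-heads : ∀ {v} R l {e} → ChainFrom F n v R → T (visits R l) → e ∈ upToV (int l) R → rank m (khead e) ≤ l
  upToV-heads (x ∷ R) l (refl , ise , ch) vis e∈ with khead x ==V int l in hd
  upToV-heads (x ∷ R) l (refl , ise , ch) vis (here refl) | true = ≤-reflexive (head≡int x l (≡true⇒T hd))
  upToV-heads (x ∷ R) l (refl , ise , ch) vis (here refl) | false = <⇒≤ (visits⇒beyond-start R l ch vis)
  upToV-heads (x ∷ R) l (refl , ise , ch) vis (there e∈) | false = upToV-heads R l ch vis e∈

  inE-skip-upToV : ∀ {v} R l k B → ChainFrom F n v R → T (visits R l) → l < k → inE (upToV (int l) R ++ B) k ≡ inE B k
  inE-skip-upToV R l k B ch vis l<k = findK-++ʳ _ (upToV (int l) R) B λ {e} e∈ hd →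
    <-irrefl (head≡int e k hd) (≤-<-trans (upToV-heads R l ch vis e∈) l<k)

  inE-afterV : ∀ {v} R l k → ChainFrom F n v R → T (visits R l) → l < k → inE (afterV (int l) R) k ≡ inE R k
  inE-afterV R l k ch vis l<k =
    trans (sym (inE-skip-upToV R l k (afterV (int l) R) ch vis l<k)) (cong (λ X → inE X k) (upToV-++-afterV (int l) R))

  afterV-visits : ∀ {v} R l k → ChainFrom F n v R → T (visits R l) → T (visits R k) → l < k →
    T (visits (afterV (int l) R) k)
  afterV-visits R l k ch vl vk l<k with findK-complete _ R vk
  ... | e , in≡ = inE≡just⇒visits (afterV (int l) R) k (trans (inE-afterV R l k ch vl l<k) in≡)

  inE-upToV : ∀ R k → inE (upToV (int k) R) k ≡ inE R k
  inE-upToV [] k = refl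
  inE-upToV (e ∷ R) k with khead e ==V int k in hd
  ... | true rewrite hd = refl
  ... | false rewrite hd = inE-upToV R k

  swapSeg-inE : ∀ {v w} P Q l k → ChainFrom F n v P → ChainFrom F n w Q → T (visits P l) → T (visits Q l) →
    T (visits Q k) → l < k → inE (swapSeg l k P Q) k ≡ inE Q k
  swapSeg-inE P Q l k chP chQ vPl vQl vQk l<k
    with findK-complete (λ e → khead e ==V int k) (afterV (int l) Q) (afterV-visits Q l k chQ vQl vQk l<k)
  ... | e , in≡ = begin
    inE (swapSeg l k P Q) k                                ≡⟨ inE-skip-upToV P l k _ chP vPl l<k ⟩
    inE (upToV (int k) (afterV (int l) Q) ++ afterV (int k) P) k
      ≡⟨ findK-++ˡ _ (upToV (int k) (afterV (int l) Q)) _ (trans (inE-upToV (afterV (int l) Q) k) in≡) ⟩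
    just e                                                 ≡⟨ sym in≡ ⟩
    inE (afterV (int l) Q) k                               ≡⟨ inE-afterV Q l k chQ vQl l<k ⟩
    inE Q k                                                ∎
    where open ≡-Reasoning

  swapSeg-chain : ∀ {v w} P Q l k → ChainFrom F n v P → ChainFrom F n w Q → T (visits P l) → T (visits Q l) →
    T (visits P k) → T (visits Q k) → l < k → ChainFrom F n v (swapSeg l k P Q)
  swapSeg-chain P Q l k chP chQ vPl vQl vPk vQk l<k =
    chain-++ (upToV (int l) P) (upToV-chain P l chP vPl)
      (chain-++ (upToV (int k) (afterV (int l) Q))
         (upToV-chain (afterV (int l) Q) k (afterV-chain Q l chQ vQl) (afterV-visits Q l k chQ vQl vQk l<k))
         (afterV-chain P k chP vPk))

IsStrand : ℕ → ℕ → Set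
IsStrand n a = 1 ≤ a × a ≤ n

OneOf : ℕ → ℕ → ℕ → Set
OneOf s t i = i ≡ s ⊎ i ≡ t

ExactlyOne : ℕ → ℕ → ℕ → ℕ → Set
ExactlyOne s t i j = (OneOf s t i × ¬ OneOf s t j) ⊎ (¬ OneOf s t i × OneOf s t j)

exactlyOne-swap : ∀ {s t i j} → ExactlyOne s t i j → ExactlyOne t s i j
exactlyOne-swap (inj₁ (oi , ¬oj)) = inj₁ (swap oi , ¬oj ∘ swap)
exactlyOne-swap (inj₂ (¬oi , oj)) = inj₂ (¬oi ∘ swap , swap oj)

oneOfᵇ-sound : ∀ s t i → T ((i ≡ᵇ s) ∨ (i ≡ᵇ t)) → OneOf s t i
oneOfᵇ-sound s t i h with T-∨⁻ {i ≡ᵇ s} h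
... | inj₁ i≡s = inj₁ (≡ᵇ⇒≡ i s i≡s)
... | inj₂ i≡t = inj₂ (≡ᵇ⇒≡ i t i≡t)

oneOfᵇ-complete : ∀ s t i → OneOf s t i → T ((i ≡ᵇ s) ∨ (i ≡ᵇ t))
oneOfᵇ-complete s t i (inj₁ refl) = Equivalence.from T-∨ (inj₁ (≡⇒≡ᵇ i i refl))
oneOfᵇ-complete s t i (inj₂ refl) = Equivalence.from (T-∨ {i ≡ᵇ s}) (inj₂ (≡⇒≡ᵇ i i refl))

dset⇒exactlyOne : ∀ F n ρ k s t i j → DSet F n ρ k s t i j → ExactlyOne s t i j
dset⇒exactlyOne F n ρ k s t i j (_ , one) with (i ≡ᵇ s) ∨ (i ≡ᵇ t) in I | (j ≡ᵇ s) ∨ (j ≡ᵇ t) in J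
... | true | false = inj₁ (oneOfᵇ-sound s t i (≡true⇒T I) , ≡false⇒¬T J ∘ oneOfᵇ-complete s t j)
... | false | true = inj₂ (≡false⇒¬T I ∘ oneOfᵇ-complete s t i , oneOfᵇ-sound s t j (≡true⇒T J))

module Decomposition (ρ : ℕ → Path) (n k : ℕ) (D : ℕ → ℕ → Set) (s t : ℕ)
  (exactly-one : ∀ i j → D i j → ExactlyOne s t i j)
  (strands : ∀ i j → D i j → IsStrand n i × IsStrand n j)
  (s-strand : IsStrand n s) (t-strand : IsStrand n t)
  (defect-order : ∀ i j → D i j → Prec (ρ j) (ρ i) k)
  (t≺s : Prec (ρ t) (ρ s) k)
  (inE-unique : ∀ a b → IsStrand n a → IsStrand n b → T (visits (ρ a) k) → T (visits (ρ b) k) →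
                pos (inE (ρ a) k) ≡ pos (inE (ρ b) k) → inE (ρ a) k ≡ inE (ρ b) k)
  where

  p : ℕ → ℕ
  p a = pos (inE (ρ a) k)

  ≺⇒visits : ∀ {a b} → Prec (ρ a) (ρ b) k → T (visits (ρ a) k) × T (visits (ρ b) k)
  ≺⇒visits = T-∧⁻ ∘ proj₁

  ≾⇒≤ : ∀ {a b} → PrecSim (ρ a) (ρ b) k → p a ≤ p b
  ≾⇒≤ (inj₁ a≺b) = <⇒≤ (proj₂ a≺b)
  ≾⇒≤ (inj₂ a∼b) = ≤-reflexive (cong pos (proj₂ a∼b))

  trichotomy : ∀ a b → IsStrand n a → IsStrand n b → T (visits (ρ a) k) → T (visits (ρ b) k) →
    Prec (ρ a) (ρ b) k ⊎ Sim (ρ a) (ρ b) k ⊎ Prec (ρ b) (ρ a) k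
  trichotomy a b sa sb va vb with <-cmp (p a) (p b)
  ... | tri< a<b _ _ = inj₁ (T-∧⁺ va vb , a<b)
  ... | tri≈ _ a≡b _ = inj₂ (inj₁ (T-∧⁺ va vb , inE-unique a b sa sb va vb a≡b))
  ... | tri> _ _ b<a = inj₂ (inj₂ (T-∧⁺ vb va , b<a))

  𝒜 ℬ 𝒞₁ 𝒞₂ : ℕ → ℕ → Set
  𝒜 i j = D i j × Prec (ρ j) (ρ t) k
  ℬ i j = D i j × Prec (ρ s) (ρ i) k
  𝒞₁ i j = D i j × PrecSim (ρ t) (ρ j) k × Prec (ρ j) (ρ i) k × (i ≡ s) × ¬ (j ≡ t)
  𝒞₂ i j = D i j × (j ≡ t) × Prec (ρ t) (ρ i) k × PrecSim (ρ i) (ρ s) k × ¬ (i ≡ s)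

  classify : ∀ i j → D i j → 𝒜 i j ⊎ ℬ i j ⊎ 𝒞₁ i j ⊎ 𝒞₂ i j
  classify i j d with exactly-one i j d | defect-order i j d
  ... | inj₁ (inj₁ refl , ¬oj) | j≺s
    with trichotomy t j t-strand (proj₂ (strands i j d)) (proj₁ (≺⇒visits t≺s)) (proj₁ (≺⇒visits j≺s))
  ...   | inj₁ t≺j = inj₂ (inj₂ (inj₁ (d , inj₁ t≺j , j≺s , refl , ¬oj ∘ inj₂)))
  ...   | inj₂ (inj₁ t∼j) = inj₂ (inj₂ (inj₁ (d , inj₂ t∼j , j≺s , refl , ¬oj ∘ inj₂)))
  ...   | inj₂ (inj₂ j≺t) = inj₁ (d , j≺t)
  classify i j d | inj₁ (inj₂ refl , _) | j≺t = inj₁ (d , j≺t)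
  classify i j d | inj₂ (_ , inj₁ refl) | s≺i = inj₂ (inj₁ (d , s≺i))
  classify i j d | inj₂ (¬oi , inj₂ refl) | t≺i
    with trichotomy i s (proj₁ (strands i j d)) s-strand (proj₂ (≺⇒visits t≺i)) (proj₂ (≺⇒visits t≺s))
  ...   | inj₁ i≺s = inj₂ (inj₂ (inj₂ (d , refl , t≺i , inj₁ i≺s , ¬oi ∘ inj₁)))
  ...   | inj₂ (inj₁ i∼s) = inj₂ (inj₂ (inj₂ (d , refl , t≺i , inj₂ i∼s , ¬oi ∘ inj₁)))
  ...   | inj₂ (inj₂ s≺i) = inj₂ (inj₁ (d , s≺i))

  decomposition : DisjointUnion4 D 𝒜 ℬ 𝒞₁ 𝒞₂
  decomposition i j = classify i j , forget , ¬AB , ¬AC₁ , ¬AC₂ , ¬BC₁ , ¬BC₂ , ¬C₁C₂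
    where
    forget : 𝒜 i j ⊎ ℬ i j ⊎ 𝒞₁ i j ⊎ 𝒞₂ i j → D i j
    forget (inj₁ (d , _)) = d
    forget (inj₂ (inj₁ (d , _))) = d
    forget (inj₂ (inj₂ (inj₁ (d , _)))) = d
    forget (inj₂ (inj₂ (inj₂ (d , _)))) = d
    ¬AB : ¬ (𝒜 i j × ℬ i j)
    ¬AB ((d , j≺t) , (_ , s≺i)) with exactly-one i j d | defect-order i j d
    ... | inj₁ (inj₁ refl , _) | _ = <-irrefl refl (proj₂ s≺i)
    ... | inj₁ (inj₂ refl , _) | _ = <-irrefl refl (<-trans (proj₂ s≺i) (proj₂ t≺s))
    ... | inj₂ (_ , inj₁ refl) | _ = <-irrefl refl (<-trans (proj₂ j≺t) (proj₂ t≺s))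
    ... | inj₂ (_ , inj₂ refl) | _ = <-irrefl refl (proj₂ j≺t)
    ¬AC₁ : ¬ (𝒜 i j × 𝒞₁ i j)
    ¬AC₁ ((_ , j≺t) , (_ , t≾j , _)) = <-irrefl refl (<-≤-trans (proj₂ j≺t) (≾⇒≤ t≾j))
    ¬AC₂ : ¬ (𝒜 i j × 𝒞₂ i j)
    ¬AC₂ ((_ , j≺t) , (_ , refl , _)) = <-irrefl refl (proj₂ j≺t)
    ¬BC₁ : ¬ (ℬ i j × 𝒞₁ i j)
    ¬BC₁ ((_ , s≺i) , (_ , _ , _ , refl , _)) = <-irrefl refl (proj₂ s≺i)
    ¬BC₂ : ¬ (ℬ i j × 𝒞₂ i j)
    ¬BC₂ ((_ , s≺i) , (_ , _ , _ , i≾s , _)) = <-irrefl refl (<-≤-trans (proj₂ s≺i) (≾⇒≤ i≾s))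
    ¬C₁C₂ : ¬ (𝒞₁ i j × 𝒞₂ i j)
    ¬C₁C₂ ((_ , _ , _ , i≡s , _) , (_ , _ , _ , _ , i≢s)) = i≢s i≡s

PathFamily : StarNet → ℕ → (ℕ → Path) → Set
PathFamily F n ρ = ∀ a → IsStrand n a → ChainFrom F n (src a) (ρ a)

strands-of : ∀ {n i j} → 1 ≤ i → i < j → j ≤ n → IsStrand n i × IsStrand n j
strands-of 1≤i i<j j≤n = (1≤i , ≤-trans (<⇒≤ i<j) j≤n) , (≤-trans 1≤i (<⇒≤ i<j) , j≤n)

module _ {F : StarNet} {n : ℕ} (ρ : ℕ → Path) (fam : PathFamily F n ρ) where

  defect⇒≺ : ∀ {i j k} → k ≤ size F → Defect F n ρ i j k → Prec (ρ j) (ρ i) k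
  defect⇒≺ {i} {j} {k} k≤m (1≤i , i<j , j≤n , mt , odd) =
    T-∧⁺ (proj₂ (meets⇒visits mt)) (proj₁ (meets⇒visits mt)) ,
    ChainPair.odd-crossings⇒swapped F n (ρ i) (ρ j) (fam i (proj₁ strands)) (fam j (proj₂ strands)) i<j k k≤m mt odd
    where
    open Crossings F n (ρ i) (ρ j)
    strands = strands-of 1≤i i<j j≤n

  family-inE-unique : ∀ k a b → IsStrand n a → IsStrand n b → T (visits (ρ a) k) → T (visits (ρ b) k) →
    pos (inE (ρ a) k) ≡ pos (inE (ρ b) k) → inE (ρ a) k ≡ inE (ρ b) k
  family-inE-unique k a b sa sb = Chains.inE-unique F n (ρ a) (ρ b) k (fam a sa) (fam b sb)

module Exchange (F : StarNet) (n : ℕ) (π : ℕ → Path) (fam : PathFamily F n π) (s t l k : ℕ)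
  (s-strand : IsStrand n s) (t-strand : IsStrand n t) (s≢t : s ≢ t) (l<k : l < k)
  (vsl : T (visits (π s) l)) (vtl : T (visits (π t) l)) (vsk : T (visits (π s) k)) (vtk : T (visits (π t) k))
  where
  open Swapping F n

  π̂ : ℕ → Path
  π̂ = hat π s t l k

  ≡ᵇ-true : ∀ a → (a ≡ᵇ a) ≡ true
  ≡ᵇ-true a = T⇒≡true (≡⇒≡ᵇ a a refl)

  ≢⇒≡ᵇ-false : ∀ {a b} → a ≢ b → (a ≡ᵇ b) ≡ false
  ≢⇒≡ᵇ-false {a} {b} a≢b = ¬T⇒≡false (a≢b ∘ ≡ᵇ⇒≡ a b)

  π̂-s : π̂ s ≡ swapSeg l k (π s) (π t)
  π̂-s = if-cong (≡ᵇ-true s)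

  π̂-t : π̂ t ≡ swapSeg l k (π t) (π s)
  π̂-t = trans (if-cong (≢⇒≡ᵇ-false (s≢t ∘ sym))) (if-cong (≡ᵇ-true t))

  π̂-other : ∀ a → a ≢ s → a ≢ t → π̂ a ≡ π a
  π̂-other a a≢s a≢t = trans (if-cong (≢⇒≡ᵇ-false a≢s)) (if-cong (≢⇒≡ᵇ-false a≢t))

  π̂-family : PathFamily F n π̂
  π̂-family a sa with a ≟ s | a ≟ t
  ... | yes refl | _ = subst (ChainFrom F n (src s)) (sym π̂-s)
                         (swapSeg-chain (π s) (π t) l k (fam s s-strand) (fam t t-strand) vsl vtl vsk vtk l<k)
  ... | no _ | yes refl = subst (ChainFrom F n (src t)) (sym π̂-t)
                            (swapSeg-chain (π t) (π s) l k (fam t t-strand) (fam s s-strand) vtl vsl vtk vsk l<k)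
  ... | no a≢s | no a≢t = subst (ChainFrom F n (src a)) (sym (π̂-other a a≢s a≢t)) (fam a sa)

  π̂-s-enters-as-t : inE (π̂ s) k ≡ inE (π t) k
  π̂-s-enters-as-t = trans (cong (λ R → inE R k) π̂-s)
                          (swapSeg-inE (π s) (π t) l k (fam s s-strand) (fam t t-strand) vsl vtl vtk l<k)

  π̂-t-enters-as-s : inE (π̂ t) k ≡ inE (π s) k
  π̂-t-enters-as-s = trans (cong (λ R → inE R k) π̂-t)
                          (swapSeg-inE (π t) (π s) l k (fam t t-strand) (fam s s-strand) vtl vsl vsk l<k)

  visits-via-inE : ∀ R R' → inE R k ≡ inE R' k → T (visits R' k) → T (visits R k)
  visits-via-inE R R' same vis with findK-complete _ R' vis
  ... | e , in≡ = inE≡just⇒visits R k (trans same in≡)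

  π̂-order : Prec (π t) (π s) k → Prec (π̂ s) (π̂ t) k
  π̂-order (_ , t<s) = T-∧⁺ {visits (π̂ s) k} (visits-via-inE (π̂ s) (π t) π̂-s-enters-as-t vtk)
                                             (visits-via-inE (π̂ t) (π s) π̂-t-enters-as-s vsk) ,
                      subst₂ _<_ (cong pos (sym π̂-s-enters-as-t)) (cong pos (sym π̂-t-enters-as-s)) t<s

lemma4p3 : (n : ℕ) (F : StarNet) → WF n F →
    (k : ℕ) → 2 ≤ k → k ≤ size F →
    (π : ℕ → Path) → Covering F n π →
    (r t s j0 l : ℕ) →
    LeastDefect F n π k r t →
    LargestS F n π k r t s →
    RightmostCrossing F π k s t j0 l →
    DisjointUnion4 (DSet F n π k s t) (SetA F n π k s t) (SetB F n π k s t)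
                   (SetC1 F n π k s t) (SetC2 F n π k s t)
    ×
    DisjointUnion4 (DSet F n (hat π s t l k) k s t)
                   (SetA' F n (hat π s t l k) k s t) (SetB' F n (hat π s t l k) k s t)
                   (SetC1' F n (hat π s t l k) k s t) (SetC2' F n (hat π s t l k) k s t)
lemma4p3 n F _ k _ k≤m π cov r t s j₀ l _ (_ , st-defect@(1≤s , s<t , t≤n , meet , _) , _)
         (1≤j₀ , j₀<k , crossing , _ , final) =
  Decomposition.decomposition π n k (DSet F n π k s t) s t
    (dset⇒exactlyOne F n π k s t) dset-strands s-strand t-strand
    (λ _ _ → defect⇒≺ π π-family k≤m ∘ proj₁) t≺s (family-inE-unique π π-family k)
  ,
  Decomposition.decomposition π̂ n k (DSet F n π̂ k s t) t s
    (λ i j → exactlyOne-swap ∘ dset⇒exactlyOne F n π̂ k s t i j) dset-strands t-strand s-strand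
    (λ _ _ → defect⇒≺ π̂ π̂-family k≤m ∘ proj₁) (π̂-order t≺s) (family-inE-unique π̂ π̂-family k)
  where
  π-family : PathFamily F n π
  π-family a (1≤a , a≤n) = proj₁ cov a 1≤a a≤n
  dset-strands : ∀ {ρ} i j → DSet F n ρ k s t i j → IsStrand n i × IsStrand n j
  dset-strands i j ((1≤i , i<j , j≤n , _) , _) = strands-of 1≤i i<j j≤n
  s-strand = proj₁ (strands-of 1≤s s<t t≤n)
  t-strand = proj₂ (strands-of 1≤s s<t t≤n)
  t≺s = defect⇒≺ π π-family k≤m st-defect
  open Crossings F n (π s) (π t)
  l<k = ChainPair.crossing-ends-before F n (π s) (π t) (π-family s s-strand) (π-family t t-strand)
          k 1≤j₀ j₀<k k≤m crossing final meet
  visits-l = finalFrom-sound j₀ l 1≤j₀ final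
  open Exchange F n π π-family s t l k s-strand t-strand (λ s≡t → <-irrefl s≡t s<t) l<k
                (proj₁ visits-l) (proj₁ (proj₂ visits-l)) (proj₁ (meets⇒visits meet)) (proj₂ (meets⇒visits meet))
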